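{- Let $T_S(u)=T_S(u,x,y,q)$ be the generating series of shifted stacks, where $u$ marks the width of the top row, $x$ the width, $y$ the height and $q$ the area, and let $$P_1(u,x,y,q)=uxyq+y\sum_{k\ge 2}(uxq)^k(-yq;q)_{k-2}.$$ Then $$T_S(u)=P_1(u,x,y,q)+\frac{xyu^2q^2}{1-uq}\big(T_S(1)-T_S(uq)\big).$$
   Context: $(a;q)_n=(1-a)(1-aq)\cdots(1-aq^{n-1})$, so $(-yq;q)_{k}=(1+yq)\cdots(1+yq^{k})$. A shifted stack is a polyomino (considered up to translation) consisting of $n\ge1$ rows at consecutive heights $1,\dots,n$ (bottom to top), row $i$ occupying the cells in columns $a_i,\dots,b_i$ with $a_i\le b_i$, such that $a_{i+1}=a_i-1$ (each row starts one column to the left of the row below it), $b_{i+1}\ge a_i$ (consecutive rows overlap), and the sequence of right ends is weakly unimodal: there is $s$ with $b_1\le\cdots\le b_s\ge b_{s+1}\ge\cdots\ge b_n$. Its width is the number of columns it meets, its height is $n$, its area is its number of cells, and its top row width is $b_n-a_n+1$. -}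

module Defs where

open import Data.Nat as ℕ using (ℕ; zero; suc; _∸_)
open import Data.Integer as ℤ using (ℤ; +_; -_; _-_; ∣_∣)
open import Data.List using (List; []; _∷_; map; filterᵇ; length; take; drop; upTo; concatMap; foldr)
open import Data.Bool.ListAction using (any; all)
open import Data.Nat.ListAction using (sum)
open import Data.Bool using (Bool; true; false; _∧_; if_then_else_)
open import Data.Product using (_×_; _,_; proj₁; proj₂)
open import Relation.Nullary.Decidable using (⌊_⌋; yes; no)
open import Relation.Binary.PropositionalEquality using (_≡_)

-- A row is a pair (a , b) of columns: it occupies columns a, a+1, ..., b.
Row : Set
Row = ℤ × ℤ

-- A shape is the list of its rows, bottom (height 1) to top (height n).
Shape : Set
Shape = List Row

infix 4 _≤b_ _==_

_≤b_ : ℤ → ℤ → Bool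
x ≤b y = ⌊ x ℤ.≤? y ⌋

_==_ : ℤ → ℤ → Bool
x == y = ⌊ x ℤ.≟ y ⌋

consecutive : (Row → Row → Bool) → Shape → Bool
consecutive P (r ∷ s ∷ rs) = P r s ∧ consecutive P (s ∷ rs)
consecutive P _ = true

nondecreasing : List ℤ → Bool
nondecreasing (x ∷ y ∷ xs) = (x ≤b y) ∧ nondecreasing (y ∷ xs)
nondecreasing _ = true

nonincreasing : List ℤ → Bool
nonincreasing (x ∷ y ∷ xs) = (y ≤b x) ∧ nonincreasing (y ∷ xs)
nonincreasing _ = true

-- exists s (1-based s = s'+1) with b_1 ≤ … ≤ b_s ≥ b_{s+1} ≥ … ≥ b_n
weaklyUnimodal : List ℤ → Bool
weaklyUnimodal bs =
  any (λ s' → nondecreasing (take (suc s') bs) ∧ nonincreasing (drop s' bs))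
      (upTo (length bs))

-- Shifted stack, normalised modulo (horizontal) translation by a₁ = 0.
-- (Heights are 1..n by the list position, so vertical translation is fixed.)
isShiftedStack : Shape → Bool
isShiftedStack [] = false
isShiftedStack rs@((a₁ , _) ∷ _) =
  (a₁ == + 0)
  ∧ all (λ r → proj₁ r ≤b proj₂ r) rs
  ∧ consecutive (λ r s → (proj₁ s == (proj₁ r - + 1)) ∧ (proj₁ r ≤b proj₂ s)) rs
  ∧ weaklyUnimodal (map proj₂ rs)

rowWidth : Row → ℕ
rowWidth (a , b) = ∣ (b - a) ℤ.+ + 1 ∣

area : Shape → ℕ
area rs = sum (map rowWidth rs)

height : Shape → ℕ
height = length

topRowWidth : Shape → ℕ
topRowWidth [] = 0
topRowWidth (r ∷ []) = rowWidth r
topRowWidth (r ∷ s ∷ rs) = topRowWidth (s ∷ rs)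

width : Shape → ℕ
width [] = 0
width rs@((a₀ , b₀) ∷ _) =
  length (filterᵇ (λ c → any (λ r → (proj₁ r ≤b c) ∧ (c ≤b proj₂ r)) rs) columns)
  where
    lo hi : ℤ
    lo = foldr (λ r m → proj₁ r ℤ.⊓ m) a₀ rs
    hi = foldr (λ r m → proj₂ r ℤ.⊔ m) b₀ rs
    columns : List ℤ
    columns = map (λ k → lo ℤ.+ + k) (upTo (∣ hi - lo ∣ ℕ.+ 1))

-- Every normalised shifted stack of area A occurs exactly once here.
lengthLists : ℕ → ℕ → List (List ℕ)
lengthLists zero A = [] ∷ []
lengthLists (suc n) A = concatMap (λ l → map (suc l ∷_) (lengthLists n A)) (upTo A)

toShape : ℕ → List ℕ → Shape
toShape i [] = []
toShape i (l ∷ ls) = (- (+ i) , (- (+ i)) ℤ.+ + l - + 1) ∷ toShape (suc i) ls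

candidates : ℕ → List Shape
candidates A = concatMap (λ n → map (toShape 0) (lengthLists (suc n) A)) (upTo A)

stacksOfArea : ℕ → List Shape
stacksOfArea A = filterᵇ (λ s → isShiftedStack s ∧ (area s ℕ.≡ᵇ A)) (candidates A)

-- Formal power series in u, x, y, q with integer coefficients:
-- F t w h a = coefficient of u^t x^w y^h q^a.

Series : Set
Series = ℕ → ℕ → ℕ → ℕ → ℤ

_≈_ : Series → Series → Set
F ≈ G = ∀ t w h a → F t w h a ≡ G t w h a

infix 4 _≈_
infixl 6 _⊕_ _⊖_
infixl 7 _⊛_

∑≤ : ℕ → (ℕ → ℤ) → ℤ
∑≤ zero f = f 0
∑≤ (suc n) f = ∑≤ n f ℤ.+ f (suc n)

_⊕_ : Series → Series → Series
(F ⊕ G) t w h a = F t w h a ℤ.+ G t w h a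

_⊖_ : Series → Series → Series
(F ⊖ G) t w h a = F t w h a - G t w h a

_⊛_ : Series → Series → Series
(F ⊛ G) t w h a =
  ∑≤ t λ i → ∑≤ w λ j → ∑≤ h λ k → ∑≤ a λ l →
    F i j k l ℤ.* G (t ∸ i) (w ∸ j) (h ∸ k) (a ∸ l)

mono : ℕ → ℕ → ℕ → ℕ → Series
mono i j k l t w h a =
  if (i ℕ.≡ᵇ t) ∧ (j ℕ.≡ᵇ w) ∧ (k ℕ.≡ᵇ h) ∧ (l ℕ.≡ᵇ a) then + 1 else + 0

zeroS : Series
zeroS _ _ _ _ = + 0

oneS : Series
oneS = mono 0 0 0 0

_^S_ : Series → ℕ → Series
F ^S zero = oneS
F ^S suc n = F ⊛ (F ^S n)

-- Σ_{k ≥ 0} F k, for a family where F k is divisible by q^k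
-- (so only k ≤ a contributes to the coefficient of q^a).
Σq : (ℕ → Series) → Series
Σq F t w h a = ∑≤ a (λ k → F k t w h a)

poch : ℕ → Series
poch zero = oneS
poch (suc m) = poch m ⊛ (oneS ⊕ mono 0 0 1 (suc m))

inv1-uq : Series
inv1-uq = Σq (λ m → mono 1 0 0 1 ^S m)

substUq : Series → Series
substUq F t w h a with t ℕ.≤? a
... | yes _ = F t w h (a ∸ t)
... | no _ = + 0

countStacks : ℕ → (Shape → Bool) → ℤ
countStacks A p = + length (filterᵇ p (stacksOfArea A))

T-S : Series
T-S t w h a = countStacks a
  (λ s → (topRowWidth s ℕ.≡ᵇ t) ∧ (width s ℕ.≡ᵇ w) ∧ (height s ℕ.≡ᵇ h))

T-S1 : Series
T-S1 zero w h a = countStacks a (λ s → (width s ℕ.≡ᵇ w) ∧ (height s ℕ.≡ᵇ h))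
T-S1 (suc t) w h a = + 0

-- P₁ = uxyq + y Σ_{k≥2} (uxq)^k (-yq;q)_{k-2}   (summation index k = j + 2)
P₁ : Series
P₁ = mono 1 1 1 1 ⊕ mono 0 0 1 0 ⊛ Σq (λ j → (mono 1 1 0 1 ^S (j ℕ.+ 2)) ⊛ poch j)

-- A stack is determined by its list of row lengths, and every statistic is read off that
-- list.  Remove the top row, of length t, from a stack with at least two rows, and let l be
-- the length of the row below.  If t ≤ l + 1, what remains is an arbitrary stack with top
-- row l ≥ t - 1, one column narrower; summing (uq)ᵗ over 2 ≤ t ≤ l + 1 gives
-- u²q² (1 - (uq)ˡ) / (1 - uq), whence the term x y u²q² (T_S(1) - T_S(uq)) / (1 - uq).
-- Otherwise the right ends rise at the top and hence all the way up: the lower rows form a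
-- strict partition into parts ≤ t - 2, counted by (-yq;q)_{t-2}, under a top row as wide as
-- the whole stack.  Together with the single cell these are the terms of P₁.
module Submission where

open import Defs

module Counting where

  open import Data.Nat using (ℕ; zero; suc; _+_; _∸_; _≤_; _<_; z≤n; s≤s; _<ᵇ_; _≡ᵇ_)
  open import Data.Nat.Properties
  open import Data.Nat.ListAction using (sum)
  open import Data.Bool using (Bool; true; false; _∧_; not; if_then_else_)
  open import Data.Bool.Properties using (∧-assoc; ∧-identityʳ; ∧-zeroʳ)
  open import Data.List using (List; []; _∷_; _++_; _∷ʳ_; map; filterᵇ; length; upTo; applyUpTo; concatMap)
  open import Data.List.Properties using (filter-++; length-++)
  open import Data.List.Relation.Unary.All using (All; []; _∷_)
  open import Data.Product using (_×_; _,_)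
  open import Function using (_∘_; id)
  open import Algebra.Properties.CommutativeSemigroup +-commutativeSemigroup using (interchange)
  open import Relation.Binary.PropositionalEquality
  open import Relation.Nullary using (contradiction)
  open import Relation.Nullary.Decidable using (T?; dec-true; dec-false)
  open import Relation.Nullary.Reflects using (Reflects; ofⁿ)
  open ≡-Reasoning

  ∑< : ℕ → (ℕ → ℕ) → ℕ
  ∑< zero    f = 0
  ∑< (suc n) f = f 0 + ∑< n (f ∘ suc)

  ∑<-cong : ∀ n {f g : ℕ → ℕ} → (∀ i → i < n → f i ≡ g i) → ∑< n f ≡ ∑< n g
  ∑<-cong zero    eq = refl
  ∑<-cong (suc n) eq = cong₂ _+_ (eq 0 (s≤s z≤n)) (∑<-cong n (λ i i<n → eq (suc i) (s≤s i<n)))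

  ∑<-zero : ∀ n {f : ℕ → ℕ} → (∀ i → i < n → f i ≡ 0) → ∑< n f ≡ 0
  ∑<-zero zero    eq = refl
  ∑<-zero (suc n) eq = cong₂ _+_ (eq 0 (s≤s z≤n)) (∑<-zero n (λ i i<n → eq (suc i) (s≤s i<n)))

  ∑<-+ : ∀ n (f g : ℕ → ℕ) → ∑< n (λ i → f i + g i) ≡ ∑< n f + ∑< n g
  ∑<-+ zero    f g = refl
  ∑<-+ (suc n) f g =
    trans (cong (f 0 + g 0 +_) (∑<-+ n (f ∘ suc) (g ∘ suc))) (interchange (f 0) (g 0) _ _)

  ∑<-swap : ∀ n m (f : ℕ → ℕ → ℕ) → ∑< n (λ i → ∑< m (f i)) ≡ ∑< m (λ j → ∑< n (λ i → f i j))
  ∑<-swap zero    m f = sym (∑<-zero m (λ _ _ → refl))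
  ∑<-swap (suc n) m f = begin
    ∑< m (f 0) + ∑< n (λ i → ∑< m (f (suc i)))        ≡⟨ cong (∑< m (f 0) +_) (∑<-swap n m (f ∘ suc)) ⟩
    ∑< m (f 0) + ∑< m (λ j → ∑< n (λ i → f (suc i) j)) ≡⟨ ∑<-+ m (f 0) _ ⟨
    ∑< m (λ j → f 0 j + ∑< n (λ i → f (suc i) j))      ∎

  ∑<-suc : ∀ n (f : ℕ → ℕ) → ∑< (suc n) f ≡ ∑< n f + f n
  ∑<-suc zero    f = +-comm (f 0) 0
  ∑<-suc (suc n) f = trans (cong (f 0 +_) (∑<-suc n (f ∘ suc))) (sym (+-assoc (f 0) _ _))

  ∑<-truncate : ∀ {n} s (f : ℕ → ℕ) → (∀ i → s ≤ i → f i ≡ 0) → s ≤ n → ∑< n f ≡ ∑< s f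
  ∑<-truncate {n}     zero    f eq _         = ∑<-zero n (λ i _ → eq i z≤n)
  ∑<-truncate {suc n} (suc s) f eq (s≤s s≤n) =
    cong (f 0 +_) (∑<-truncate s (f ∘ suc) (λ i s≤i → eq (suc i) (s≤s s≤i)) s≤n)

  ∑<-pointed : ∀ n c (f : ℕ → ℕ) → (∀ i → i ≢ c → f i ≡ 0) → ∑< n f ≡ (if c <ᵇ n then f c else 0)
  ∑<-pointed zero    c       f eq = refl
  ∑<-pointed (suc n) zero    f eq =
    trans (cong (f 0 +_) (∑<-zero n (λ i _ → eq (suc i) (λ ())))) (+-identityʳ (f 0))
  ∑<-pointed (suc n) (suc c) f eq =
    cong₂ _+_ (eq 0 (λ ())) (∑<-pointed n c (f ∘ suc) (λ i i≢c → eq (suc i) (i≢c ∘ suc-injective)))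

  iverson : Bool → ℕ
  iverson true  = 1
  iverson false = 0

  #ᵇ : {A : Set} → (A → Bool) → List A → ℕ
  #ᵇ P xs = length (filterᵇ P xs)

  #ᵇ-∷ : ∀ {A : Set} (P : A → Bool) x xs → #ᵇ P (x ∷ xs) ≡ iverson (P x) + #ᵇ P xs
  #ᵇ-∷ P x xs with P x
  ... | true  = refl
  ... | false = refl

  #ᵇ-++ : ∀ {A : Set} (P : A → Bool) xs ys → #ᵇ P (xs ++ ys) ≡ #ᵇ P xs + #ᵇ P ys
  #ᵇ-++ P xs ys = trans (cong length (filter-++ (T? ∘ P) xs ys)) (length-++ (filterᵇ P xs))

  #ᵇ-map : ∀ {A B : Set} (P : B → Bool) (g : A → B) xs → #ᵇ P (map g xs) ≡ #ᵇ (P ∘ g) xs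
  #ᵇ-map P g []       = refl
  #ᵇ-map P g (x ∷ xs) = begin
    #ᵇ P (g x ∷ map g xs)                ≡⟨ #ᵇ-∷ P (g x) (map g xs) ⟩
    iverson (P (g x)) + #ᵇ P (map g xs)  ≡⟨ cong (iverson (P (g x)) +_) (#ᵇ-map P g xs) ⟩
    iverson (P (g x)) + #ᵇ (P ∘ g) xs    ≡⟨ #ᵇ-∷ (P ∘ g) x xs ⟨
    #ᵇ (P ∘ g) (x ∷ xs)                  ∎

  #ᵇ-concatMap-upTo : ∀ {B : Set} (P : B → Bool) (g : ℕ → List B) n →
                      #ᵇ P (concatMap g (upTo n)) ≡ ∑< n (λ i → #ᵇ P (g i))
  #ᵇ-concatMap-upTo P g n = go id n
    where
    go : ∀ h n → #ᵇ P (concatMap g (applyUpTo h n)) ≡ ∑< n (#ᵇ P ∘ g ∘ h)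
    go h zero    = refl
    go h (suc n) = trans (#ᵇ-++ P (g (h 0)) _) (cong (#ᵇ P (g (h 0)) +_) (go (h ∘ suc) n))

  #ᵇ-split : ∀ {A : Set} (P Q : A → Bool) xs →
             #ᵇ P xs ≡ #ᵇ (λ x → P x ∧ Q x) xs + #ᵇ (λ x → P x ∧ not (Q x)) xs
  #ᵇ-split P Q []       = refl
  #ᵇ-split {A} P Q (x ∷ xs) = begin
    #ᵇ P (x ∷ xs)
      ≡⟨ #ᵇ-∷ P x xs ⟩
    iverson (P x) + #ᵇ P xs
      ≡⟨ cong₂ _+_ (iverson-split (P x) (Q x)) (#ᵇ-split P Q xs) ⟩
    iverson (P x ∧ Q x) + iverson (P x ∧ not (Q x)) + (#ᵇ P∧Q xs + #ᵇ P∧¬Q xs)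
      ≡⟨ interchange (iverson (P x ∧ Q x)) _ _ _ ⟩
    iverson (P x ∧ Q x) + #ᵇ P∧Q xs + (iverson (P x ∧ not (Q x)) + #ᵇ P∧¬Q xs)
      ≡⟨ cong₂ _+_ (#ᵇ-∷ P∧Q x xs) (#ᵇ-∷ P∧¬Q x xs) ⟨
    #ᵇ P∧Q (x ∷ xs) + #ᵇ P∧¬Q (x ∷ xs)
      ∎
    where
    P∧Q P∧¬Q : A → Bool
    P∧Q   x = P x ∧ Q x
    P∧¬Q  x = P x ∧ not (Q x)
    iverson-split : ∀ p q → iverson p ≡ iverson (p ∧ q) + iverson (p ∧ not q)
    iverson-split false q     = refl
    iverson-split true  true  = refl
    iverson-split true  false = refl

  #ᵇ-filterᵇ : ∀ {A : Set} (P Q : A → Bool) xs → #ᵇ P (filterᵇ Q xs) ≡ #ᵇ (λ x → Q x ∧ P x) xs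
  #ᵇ-filterᵇ P Q []       = refl
  #ᵇ-filterᵇ P Q (x ∷ xs) rewrite #ᵇ-∷ (λ x → Q x ∧ P x) x xs with Q x
  ... | false = #ᵇ-filterᵇ P Q xs
  ... | true  = trans (#ᵇ-∷ P x _) (cong (iverson (P x) +_) (#ᵇ-filterᵇ P Q xs))

  Lengths : ℕ → List ℕ → Set
  Lengths n ls = length ls ≡ n × All (1 ≤_) ls

  count : ℕ → ℕ → (List ℕ → Bool) → ℕ
  count n A P = #ᵇ P (lengthLists n A)

  count-zero : ∀ A P → count 0 A P ≡ iverson (P [])
  count-zero A P = trans (#ᵇ-∷ P [] []) (+-identityʳ _)

  count-suc : ∀ n A P → count (suc n) A P ≡ ∑< A (λ l → count n A (P ∘ (suc l ∷_)))
  count-suc n A P =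
    trans (#ᵇ-concatMap-upTo P _ A) (∑<-cong A (λ l _ → #ᵇ-map P (suc l ∷_) (lengthLists n A)))

  count-∷ʳ : ∀ n A P → count (suc n) A P ≡ ∑< A (λ l → count n A (λ ls → P (ls ∷ʳ suc l)))
  count-∷ʳ zero    A P =
    trans (count-suc 0 A P) (∑<-cong A (λ l _ →
      trans (count-zero A (P ∘ (suc l ∷_))) (sym (count-zero A (λ ls → P (ls ∷ʳ suc l))))))
  count-∷ʳ (suc n) A P = begin
    count (suc (suc n)) A P
      ≡⟨ count-suc (suc n) A P ⟩
    ∑< A (λ l₀ → count (suc n) A (P ∘ (suc l₀ ∷_)))
      ≡⟨ ∑<-cong A (λ l₀ _ → count-∷ʳ n A (P ∘ (suc l₀ ∷_))) ⟩
    ∑< A (λ l₀ → ∑< A (λ l → count n A (λ ls → P (suc l₀ ∷ ls ∷ʳ suc l))))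
      ≡⟨ ∑<-swap A A _ ⟩
    ∑< A (λ l → ∑< A (λ l₀ → count n A (λ ls → P (suc l₀ ∷ ls ∷ʳ suc l))))
      ≡⟨ ∑<-cong A (λ l _ → count-suc n A (λ ls → P (ls ∷ʳ suc l))) ⟨
    ∑< A (λ l → count (suc n) A (λ ls → P (ls ∷ʳ suc l)))
      ∎

  count-cong : ∀ n A {P Q : List ℕ → Bool} → (∀ ls → Lengths n ls → P ls ≡ Q ls) →
               count n A P ≡ count n A Q
  count-cong zero    A {P} {Q} eq =
    trans (count-zero A P) (trans (cong iverson (eq [] (refl , []))) (sym (count-zero A Q)))
  count-cong (suc n) A {P} {Q} eq = begin
    count (suc n) A P                          ≡⟨ count-suc n A P ⟩
    ∑< A (λ l → count n A (P ∘ (suc l ∷_)))    ≡⟨ ∑<-cong A (λ l _ → count-cong n A (eq∷ l)) ⟩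
    ∑< A (λ l → count n A (Q ∘ (suc l ∷_)))    ≡⟨ count-suc n A Q ⟨
    count (suc n) A Q                          ∎
    where
    eq∷ : ∀ l ls → Lengths n ls → P (suc l ∷ ls) ≡ Q (suc l ∷ ls)
    eq∷ l ls (len , pos) = eq (suc l ∷ ls) (cong suc len , s≤s z≤n ∷ pos)

  count-none : ∀ n A {P : List ℕ → Bool} → (∀ ls → Lengths n ls → P ls ≡ false) → count n A P ≡ 0
  count-none n A eq = trans (count-cong n A eq) (#ᵇ-false (lengthLists n A))
    where
    #ᵇ-false : ∀ xs → #ᵇ (λ (_ : List ℕ) → false) xs ≡ 0
    #ᵇ-false []       = refl
    #ᵇ-false (_ ∷ xs) = #ᵇ-false xs

  count-split : ∀ n A (P Q : List ℕ → Bool) →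
                count n A P ≡ count n A (λ ls → P ls ∧ Q ls) + count n A (λ ls → P ls ∧ not (Q ls))
  count-split n A P Q = #ᵇ-split P Q (lengthLists n A)

  count-bound : ∀ n {A} s (P : List ℕ → Bool) → (∀ ls → P ls ≡ true → sum ls ≡ s) → s ≤ A →
                count n A P ≡ count n s P
  count-bound zero    s P sum≡s s≤A = refl
  count-bound (suc n) {A} s P sum≡s s≤A = begin
    count (suc n) A P                                 ≡⟨ count-suc n A P ⟩
    ∑< A (λ l → count n A (P ∘ (suc l ∷_)))           ≡⟨ ∑<-truncate s _ tooLong s≤A ⟩
    ∑< s (λ l → count n A (P ∘ (suc l ∷_)))           ≡⟨ ∑<-cong s (λ l _ → count-bound n _ _ (rest l) (rest≤ s≤A l)) ⟩
    ∑< s (λ l → count n (s ∸ suc l) (P ∘ (suc l ∷_))) ≡⟨ ∑<-cong s (λ l _ → count-bound n _ _ (rest l) (rest≤ ≤-refl l)) ⟨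
    ∑< s (λ l → count n s (P ∘ (suc l ∷_)))           ≡⟨ count-suc n s P ⟨
    count (suc n) s P                                 ∎
    where
    rest : ∀ l ls → P (suc l ∷ ls) ≡ true → sum ls ≡ s ∸ suc l
    rest l ls P≡true = trans (sym (m+n∸m≡n (suc l) (sum ls))) (cong (_∸ suc l) (sum≡s _ P≡true))
    rest≤ : ∀ {B} → s ≤ B → ∀ l → s ∸ suc l ≤ B
    rest≤ s≤B l = ≤-trans (m∸n≤m s (suc l)) s≤B
    tooLong : ∀ l → s ≤ l → count n A (P ∘ (suc l ∷_)) ≡ 0
    tooLong l s≤l = count-none n A (λ ls _ → rejected ls (P (suc l ∷ ls)) refl)
      where
      rejected : ∀ ls b → P (suc l ∷ ls) ≡ b → b ≡ false
      rejected ls false _     = refl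
      rejected ls true  P≡true = contradiction (sum≡s _ P≡true) (>⇒≢ (s≤s (≤-trans s≤l (m≤m+n l (sum ls)))))

  length≤sum : ∀ {ls} → All (1 ≤_) ls → length ls ≤ sum ls
  length≤sum []         = z≤n
  length≤sum (1≤l ∷ ps) = +-mono-≤ 1≤l (length≤sum ps)

  count-byHeight : ∀ a h (M : List ℕ → Bool) → (∀ ls → M ls ≡ true → sum ls ≡ a) → M [] ≡ false →
    ∑< a (λ n → count (suc n) a (λ ls → M ls ∧ (suc n ≡ᵇ h))) ≡ count h a M
  count-byHeight a zero M sum≡a M[]≡false =
    trans (∑<-zero a (λ n _ → count-none (suc n) a (λ ls _ → ∧-zeroʳ (M ls))))
          (sym (trans (count-zero a M) (cong iverson M[]≡false)))
  count-byHeight a (suc h) M sum≡a _ = trans (∑<-pointed a h _ otherHeight) (onlyHeight (h <ᵇ a) (<ᵇ-reflects-< h a))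
    where
    otherHeight : ∀ n → n ≢ h → count (suc n) a (λ ls → M ls ∧ (suc n ≡ᵇ suc h)) ≡ 0
    otherHeight n n≢h = count-none (suc n) a (λ ls _ →
      trans (cong (M ls ∧_) (dec-false (n ≟ h) n≢h)) (∧-zeroʳ (M ls)))
    onlyHeight : ∀ b → Reflects (h < a) b →
                 (if b then count (suc h) a (λ ls → M ls ∧ (suc h ≡ᵇ suc h)) else 0) ≡ count (suc h) a M
    onlyHeight true  _       = count-cong (suc h) a (λ ls _ →
      trans (cong (M ls ∧_) (dec-true (h ≟ h) refl)) (∧-identityʳ (M ls)))
    onlyHeight false (ofⁿ h≮a) = sym (count-none (suc h) a rejected)
      where
      rejected : ∀ ls → Lengths (suc h) ls → M ls ≡ false
      rejected ls (len , pos) with M ls in Mls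
      ... | false = refl
      ... | true  = contradiction (subst₂ _≤_ len (sum≡a ls Mls) (length≤sum pos)) h≮a

  count-below : ∀ n A (P : List ℕ → Bool) (f : List ℕ → ℕ) k →
    count n A (λ ls → P ls ∧ (f ls <ᵇ k)) ≡ ∑< k (λ j → count n A (λ ls → P ls ∧ (f ls ≡ᵇ j)))
  count-below n A P f zero    = count-none n A (λ ls _ → ∧-zeroʳ (P ls))
  count-below n A P f (suc k) = begin
    count n A (λ ls → P ls ∧ (f ls <ᵇ suc k))
      ≡⟨ count-split n A _ (λ ls → f ls <ᵇ k) ⟩
    count n A (λ ls → (P ls ∧ (f ls <ᵇ suc k)) ∧ (f ls <ᵇ k)) +
    count n A (λ ls → (P ls ∧ (f ls <ᵇ suc k)) ∧ not (f ls <ᵇ k))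
      ≡⟨ cong₂ _+_ (count-cong n A (λ ls _ → trans (∧-assoc (P ls) _ _) (cong (P ls ∧_) (<ᵇ-suc-∧-<ᵇ (f ls) k))))
                   (count-cong n A (λ ls _ → trans (∧-assoc (P ls) _ _) (cong (P ls ∧_) (<ᵇ-suc-∧-≮ᵇ (f ls) k)))) ⟩
    count n A (λ ls → P ls ∧ (f ls <ᵇ k)) + count n A (λ ls → P ls ∧ (f ls ≡ᵇ k))
      ≡⟨ cong (_+ count n A (λ ls → P ls ∧ (f ls ≡ᵇ k))) (count-below n A P f k) ⟩
    ∑< k (λ j → count n A (λ ls → P ls ∧ (f ls ≡ᵇ j))) + count n A (λ ls → P ls ∧ (f ls ≡ᵇ k))
      ≡⟨ ∑<-suc k _ ⟨
    ∑< (suc k) (λ j → count n A (λ ls → P ls ∧ (f ls ≡ᵇ j)))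
      ∎
    where
    <ᵇ-suc-∧-<ᵇ : ∀ x k → (x <ᵇ suc k) ∧ (x <ᵇ k) ≡ (x <ᵇ k)
    <ᵇ-suc-∧-<ᵇ zero    zero    = refl
    <ᵇ-suc-∧-<ᵇ zero    (suc k) = refl
    <ᵇ-suc-∧-<ᵇ (suc x) zero    = refl
    <ᵇ-suc-∧-<ᵇ (suc x) (suc k) = <ᵇ-suc-∧-<ᵇ x k
    <ᵇ-suc-∧-≮ᵇ : ∀ x k → (x <ᵇ suc k) ∧ not (x <ᵇ k) ≡ (x ≡ᵇ k)
    <ᵇ-suc-∧-≮ᵇ zero    zero    = refl
    <ᵇ-suc-∧-≮ᵇ zero    (suc k) = refl
    <ᵇ-suc-∧-≮ᵇ (suc x) zero    = refl
    <ᵇ-suc-∧-≮ᵇ (suc x) (suc k) = <ᵇ-suc-∧-≮ᵇ x k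

module RowLengths where

  open import Data.Nat using (ℕ; suc; _+_; _≤_; _<_; _⊔_; z≤n; s≤s; _<ᵇ_; _≤ᵇ_; _≡ᵇ_)
  open import Data.Nat.Properties
  open import Data.Bool using (Bool; true; false; _∧_; _∨_; T)
  open import Data.Bool.Properties
    using (∧-assoc; ∧-identityʳ; ∧-zeroʳ; ∧-conicalˡ; ∧-conicalʳ; ∨-assoc; ∨-identityʳ; ∨-zeroʳ; ∧-distribʳ-∨)
  open import Data.Bool.ListAction using (all)
  open import Data.List using (List; []; _∷_; _∷ʳ_; length)
  open import Data.Nat.ListAction using (sum)
  open import Data.Nat.ListAction.Properties using (sum-++)
  open import Data.List.Properties using (length-++)
  open import Relation.Binary.PropositionalEquality
  open import Relation.Nullary.Decidable using (dec-true; dec-false)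
  open import Relation.Nullary.Reflects using (ofʸ)
  open Counting using (count)

  -- A stack is encoded by its row lengths l₁, …, lₙ, bottom to top: row i occupies the
  -- columns 1 - i, …, lᵢ - i, so its right end is bᵢ = lᵢ - i.  The right ends rise
  -- (bᵢ ≤ bᵢ₊₁) iff lᵢ < lᵢ₊₁ and fall (bᵢ ≥ bᵢ₊₁) iff lᵢ₊₁ ≤ lᵢ + 1.

  top : List ℕ → ℕ
  top []           = 0
  top (l ∷ [])     = l
  top (_ ∷ l ∷ ls) = top (l ∷ ls)

  rising : List ℕ → Bool
  rising (l ∷ l′ ∷ ls) = (l <ᵇ l′) ∧ rising (l′ ∷ ls)
  rising _             = true

  falling : List ℕ → Bool
  falling (l ∷ l′ ∷ ls) = (l′ ≤ᵇ suc l) ∧ falling (l′ ∷ ls)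
  falling _             = true

  unimodal : List ℕ → Bool
  unimodal []            = false
  unimodal (_ ∷ [])      = true
  unimodal (l ∷ l′ ∷ ls) = falling (l ∷ l′ ∷ ls) ∨ ((l <ᵇ l′) ∧ unimodal (l′ ∷ ls))

  -- Consecutive rows overlap iff every row above the bottom one has length at least 2.
  isStack : List ℕ → Bool
  isStack []       = false
  isStack (l ∷ ls) = all (2 ≤ᵇ_) ls ∧ unimodal (l ∷ ls)

  -- The number of columns met: counted from the first column of the top row,
  -- row i ends in column lᵢ + (n - i).
  spread : List ℕ → ℕ
  spread []       = 0
  spread (l ∷ ls) = (l + length ls) ⊔ spread ls

  withWidth : ℕ → ℕ → List ℕ → Bool
  withWidth w a ls = (isStack ls ∧ (sum ls ≡ᵇ a)) ∧ (spread ls ≡ᵇ w)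

  withTop : ℕ → ℕ → ℕ → List ℕ → Bool
  withTop t w a ls = withWidth w a ls ∧ (top ls ≡ᵇ t)

  #stacks : ℕ → ℕ → ℕ → ℕ → ℕ
  #stacks t w h a = count h a (withTop t w a)

  #stacks₁ : ℕ → ℕ → ℕ → ℕ
  #stacks₁ w h a = count h a (withWidth w a)

  ≡ᵇ-true⇒≡ : ∀ {m n} → (m ≡ᵇ n) ≡ true → m ≡ n
  ≡ᵇ-true⇒≡ {m} {n} eq = ≡ᵇ⇒≡ m n (subst T (sym eq) _)

  withWidth⇒sum≡ : ∀ w a ls → withWidth w a ls ≡ true → sum ls ≡ a
  withWidth⇒sum≡ w a ls eq = ≡ᵇ-true⇒≡ (∧-conicalʳ (isStack ls) _ (∧-conicalˡ (isStack ls ∧ (sum ls ≡ᵇ a)) _ eq))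

  withTop⇒sum≡ : ∀ t w a ls → withTop t w a ls ≡ true → sum ls ≡ a
  withTop⇒sum≡ t w a ls eq = withWidth⇒sum≡ w a ls (∧-conicalˡ (withWidth w a ls) _ eq)

  top-∷ʳ : ∀ ls x → top (ls ∷ʳ x) ≡ x
  top-∷ʳ []           x = refl
  top-∷ʳ (_ ∷ [])     x = refl
  top-∷ʳ (_ ∷ l ∷ ls) x = top-∷ʳ (l ∷ ls) x

  rising-∷ʳ : ∀ l ls x → rising ((l ∷ ls) ∷ʳ x) ≡ rising (l ∷ ls) ∧ (top (l ∷ ls) <ᵇ x)
  rising-∷ʳ l []        x = ∧-identityʳ _
  rising-∷ʳ l (l′ ∷ ls) x = trans (cong ((l <ᵇ l′) ∧_) (rising-∷ʳ l′ ls x)) (sym (∧-assoc (l <ᵇ l′) _ _))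

  falling-∷ʳ : ∀ l ls x → falling ((l ∷ ls) ∷ʳ x) ≡ falling (l ∷ ls) ∧ (x ≤ᵇ suc (top (l ∷ ls)))
  falling-∷ʳ l []        x = ∧-identityʳ _
  falling-∷ʳ l (l′ ∷ ls) x = trans (cong ((l′ ≤ᵇ suc l) ∧_) (falling-∷ʳ l′ ls x)) (sym (∧-assoc (l′ ≤ᵇ suc l) _ _))

  unimodal-∷ʳ : ∀ l ls x → unimodal ((l ∷ ls) ∷ʳ x) ≡
    (unimodal (l ∷ ls) ∧ (x ≤ᵇ suc (top (l ∷ ls)))) ∨ (rising (l ∷ ls) ∧ (top (l ∷ ls) <ᵇ x))
  unimodal-∷ʳ l []        x = cong₂ _∨_ (∧-identityʳ (x ≤ᵇ suc l)) (∧-identityʳ (l <ᵇ x))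
  unimodal-∷ʳ l (l′ ∷ ls) x =
    trans (cong₂ (λ p q → p ∨ ((l <ᵇ l′) ∧ q)) (falling-∷ʳ l (l′ ∷ ls) x) (unimodal-∷ʳ l′ ls x))
          (regroup (falling (l ∷ l′ ∷ ls)) (l <ᵇ l′) (unimodal (l′ ∷ ls)) (rising (l′ ∷ ls)) _ _)
    where
    regroup : ∀ f b u r d i → (f ∧ d) ∨ (b ∧ ((u ∧ d) ∨ (r ∧ i))) ≡ ((f ∨ (b ∧ u)) ∧ d) ∨ ((b ∧ r) ∧ i)
    regroup f false u r d i = cong (λ z → (z ∧ d) ∨ false) (sym (∨-identityʳ f))
    regroup f true  u r d i = sym (trans (cong (_∨ (r ∧ i)) (∧-distribʳ-∨ d f u)) (∨-assoc (f ∧ d) (u ∧ d) (r ∧ i)))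

  all-∷ʳ : ∀ (p : ℕ → Bool) xs x → all p (xs ∷ʳ x) ≡ all p xs ∧ p x
  all-∷ʳ p []       x = ∧-identityʳ (p x)
  all-∷ʳ p (y ∷ xs) x = trans (cong (p y ∧_) (all-∷ʳ p xs x)) (sym (∧-assoc (p y) _ _))

  isStack-∷ʳ : ∀ l ls x → isStack ((l ∷ ls) ∷ʳ x) ≡
    (all (2 ≤ᵇ_) ls ∧ (2 ≤ᵇ x)) ∧
    ((unimodal (l ∷ ls) ∧ (x ≤ᵇ suc (top (l ∷ ls)))) ∨ (rising (l ∷ ls) ∧ (top (l ∷ ls) <ᵇ x)))
  isStack-∷ʳ l ls x = cong₂ _∧_ (all-∷ʳ (2 ≤ᵇ_) ls x) (unimodal-∷ʳ l ls x)

  sum-∷ʳ : ∀ ls x → sum (ls ∷ʳ x) ≡ sum ls + x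
  sum-∷ʳ ls x = trans (sum-++ ls (x ∷ [])) (cong (sum ls +_) (+-identityʳ x))

  length-∷ʳ : ∀ (ls : List ℕ) x → length (ls ∷ʳ x) ≡ suc (length ls)
  length-∷ʳ ls x = trans (length-++ ls) (+-comm (length ls) 1)

  spread-∷ʳ : ∀ l ls x → spread ((l ∷ ls) ∷ʳ x) ≡ x ⊔ suc (spread (l ∷ ls))
  spread-∷ʳ l []        x = begin
    (l + 1) ⊔ ((x + 0) ⊔ 0) ≡⟨ cong₂ _⊔_ (+-comm l 1) (trans (⊔-identityʳ _) (+-identityʳ x)) ⟩
    suc l ⊔ x               ≡⟨ ⊔-comm (suc l) x ⟩
    x ⊔ suc l               ≡⟨ cong (λ z → x ⊔ suc z) (trans (⊔-identityʳ _) (+-identityʳ l)) ⟨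
    x ⊔ suc ((l + 0) ⊔ 0)   ∎
    where open ≡-Reasoning
  spread-∷ʳ l (l′ ∷ ls) x = begin
    (l + length ((l′ ∷ ls) ∷ʳ x)) ⊔ spread ((l′ ∷ ls) ∷ʳ x)
      ≡⟨ cong₂ _⊔_ (trans (cong (l +_) (length-∷ʳ (l′ ∷ ls) x)) (+-suc l _)) (spread-∷ʳ l′ ls x) ⟩
    suc k ⊔ (x ⊔ suc (spread (l′ ∷ ls)))
      ≡⟨ ⊔-assoc (suc k) x _ ⟨
    (suc k ⊔ x) ⊔ suc (spread (l′ ∷ ls))
      ≡⟨ cong (_⊔ suc (spread (l′ ∷ ls))) (⊔-comm (suc k) x) ⟩
    (x ⊔ suc k) ⊔ suc (spread (l′ ∷ ls))
      ≡⟨ ⊔-assoc x _ _ ⟩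
    x ⊔ suc (k ⊔ spread (l′ ∷ ls))
      ∎
    where
    open ≡-Reasoning
    k : ℕ
    k = l + length (l′ ∷ ls)

  l≤spread : ∀ l ls → l ≤ spread (l ∷ ls)
  l≤spread l ls = ≤-trans (m≤m+n l (length ls)) (m≤m⊔n _ _)

  top≤spread : ∀ l ls → top (l ∷ ls) ≤ spread (l ∷ ls)
  top≤spread l []        = ≤-trans (≤-reflexive (sym (+-identityʳ l))) (m≤m⊔n (l + 0) 0)
  top≤spread l (l′ ∷ ls) = ≤-trans (top≤spread l′ ls) (m≤n⊔m (l + length (l′ ∷ ls)) _)

  rising⇒l+length≤top : ∀ l ls → rising (l ∷ ls) ≡ true → l + length ls ≤ top (l ∷ ls)
  rising⇒l+length≤top l []        _ = ≤-reflexive (+-identityʳ l)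
  rising⇒l+length≤top l (l′ ∷ ls) r with l <ᵇ l′ | <ᵇ-reflects-< l l′
  ... | true | ofʸ l<l′ = begin
    l + suc (length ls) ≡⟨ +-suc l (length ls) ⟩
    suc l + length ls   ≤⟨ +-monoˡ-≤ (length ls) l<l′ ⟩
    l′ + length ls      ≤⟨ rising⇒l+length≤top l′ ls r ⟩
    top (l′ ∷ ls)       ∎
    where open ≤-Reasoning

  rising⇒spread≡top : ∀ l ls → rising (l ∷ ls) ≡ true → spread (l ∷ ls) ≡ top (l ∷ ls)
  rising⇒spread≡top l []        _ = trans (⊔-identityʳ _) (+-identityʳ l)
  rising⇒spread≡top l (l′ ∷ ls) r =
    trans (cong ((l + length (l′ ∷ ls)) ⊔_) (rising⇒spread≡top l′ ls (∧-conicalʳ (l <ᵇ l′) _ r)))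
          (m≤n⇒m⊔n≡n (rising⇒l+length≤top l (l′ ∷ ls) r))

  rising⇒unimodal : ∀ l ls → rising (l ∷ ls) ≡ true → unimodal (l ∷ ls) ≡ true
  rising⇒unimodal l []        _ = refl
  rising⇒unimodal l (l′ ∷ ls) r with l <ᵇ l′
  ... | true = trans (cong (falling (l ∷ l′ ∷ ls) ∨_) (rising⇒unimodal l′ ls r)) (∨-zeroʳ _)

  rising⇒overlapping : ∀ l ls → 1 ≤ l → rising (l ∷ ls) ≡ true → all (2 ≤ᵇ_) ls ≡ true
  rising⇒overlapping l []        _   _ = refl
  rising⇒overlapping l (l′ ∷ ls) 1≤l r with l <ᵇ l′ | <ᵇ-reflects-< l l′
  ... | true | ofʸ l<l′ =
    cong₂ _∧_ (dec-true (2 ≤? l′) (≤-trans (s≤s 1≤l) l<l′)) (rising⇒overlapping l′ ls (<⇒≤ (≤-trans (s≤s 1≤l) l<l′)) r)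

  unimodal-∨-rising : ∀ l ls b → unimodal (l ∷ ls) ∨ (rising (l ∷ ls) ∧ b) ≡ unimodal (l ∷ ls)
  unimodal-∨-rising l ls b with rising (l ∷ ls) in r
  ... | false = ∨-identityʳ _
  ... | true rewrite rising⇒unimodal l ls r = refl

  isStack-∷ʳ-falling : ∀ l ls t → 2 ≤ t → t ≤ suc (top (l ∷ ls)) →
                       isStack ((l ∷ ls) ∷ʳ t) ≡ isStack (l ∷ ls)
  isStack-∷ʳ-falling l ls t 2≤t t≤1+top
    rewrite isStack-∷ʳ l ls t | dec-true (2 ≤? t) 2≤t | dec-true (t ≤? suc (top (l ∷ ls))) t≤1+top =
    cong₂ _∧_ (∧-identityʳ _)
              (trans (cong (_∨ (rising (l ∷ ls) ∧ (top (l ∷ ls) <ᵇ t))) (∧-identityʳ (unimodal (l ∷ ls))))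
                     (unimodal-∨-rising l ls _))

  isStack-∷ʳ-rising : ∀ l ls t → 1 ≤ l → suc (top (l ∷ ls)) < t →
                      isStack ((l ∷ ls) ∷ʳ t) ≡ rising (l ∷ ls)
  isStack-∷ʳ-rising l ls t 1≤l 1+top<t
    rewrite isStack-∷ʳ l ls t
          | dec-true (2 ≤? t) (≤-trans (s≤s (s≤s z≤n)) 1+top<t)
          | dec-false (t ≤? suc (top (l ∷ ls))) (<⇒≱ 1+top<t)
          | dec-true (top (l ∷ ls) <? t) (<-trans (n<1+n _) 1+top<t)
          | ∧-zeroʳ (unimodal (l ∷ ls)) | ∧-identityʳ (all (2 ≤ᵇ_) ls) | ∧-identityʳ (rising (l ∷ ls))
    with rising (l ∷ ls) in r
  ... | false = ∧-zeroʳ _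
  ... | true  = trans (∧-identityʳ _) (rising⇒overlapping l ls 1≤l r)

  spread-∷ʳ-falling : ∀ l ls t → t ≤ suc (top (l ∷ ls)) → spread ((l ∷ ls) ∷ʳ t) ≡ suc (spread (l ∷ ls))
  spread-∷ʳ-falling l ls t t≤1+top =
    trans (spread-∷ʳ l ls t) (m≤n⇒m⊔n≡n (≤-trans t≤1+top (s≤s (top≤spread l ls))))

  spread-∷ʳ-rising : ∀ l ls t → rising (l ∷ ls) ≡ true → top (l ∷ ls) < t → spread ((l ∷ ls) ∷ʳ t) ≡ t
  spread-∷ʳ-rising l ls t r top<t =
    trans (spread-∷ʳ l ls t) (m≥n⇒m⊔n≡m (subst (_< t) (sym (rising⇒spread≡top l ls r)) top<t))

module Shapes where

  open import Data.Nat as ℕ using (ℕ; zero; suc; _≤ᵇ_; _<ᵇ_)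
  import Data.Nat.Properties as ℕₚ
  open import Data.Integer as ℤ using (ℤ; +_; -_; _-_; ∣_∣; _⊔_; _⊓_; _≤_; +≤+)
  open import Data.Integer.Properties
    using (pos-+; +-identityˡ; +-monoˡ-≤; drop‿+≤+; i≤j⇒i⊔j≡j; i≥j⇒i⊔j≡i; i≤j⇒i⊓j≡i; i≥j⇒i⊓j≡j;
           neg-≤-pos; neg-mono-≤; ⊓-assoc; ⊔-assoc; i≤i+j; i≤i⊔j; ≰⇒>; ≤-total; <⇒≤; ≤-<-trans; ≤-reflexive; ≤-trans)
  open import Data.Integer.Tactic.RingSolver using (solve-∀)
  open import Data.Bool using (Bool; true; false; _∧_; _∨_)
  open import Data.Bool.Properties using (∧-assoc; ∧-zeroʳ; ∧-conicalˡ; ∧-conicalʳ; ∧-distribˡ-∨; ∨-zeroʳ; T-≡)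
  open import Data.Bool.ListAction using (or; any; all)
  open import Data.List using (List; []; _∷_; map; filterᵇ; length; take; drop; upTo; applyUpTo; foldr)
  open import Data.List.Properties using (map-applyUpTo; filter-all; length-applyUpTo)
  open import Data.List.Relation.Unary.All using (All; []; _∷_)
  open import Data.List.Relation.Unary.All.Properties using (applyUpTo⁺₁)
  open import Data.Nat.ListAction using (sum)
  open import Data.Product using (_,_; proj₁; proj₂)
  open import Data.Sum using (inj₁; inj₂)
  open import Function using (_∘_; id; _⇔_; mk⇔; Equivalence)
  open import Function.Properties.Equivalence using () renaming (trans to ⇔-trans)
  open import Relation.Binary.PropositionalEquality
  open import Relation.Nullary using (Dec; does; yes; no; contradiction)
  open import Relation.Nullary.Decidable using (does-⇔; dec-true; isYes≗does; T?)
  open import Defs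
  open RowLengths

  [x-n]≤[y-m]⇔[x+m]≤[y+n] : ∀ x n y m → (+ x - + n ≤ + y - + m) ⇔ (x ℕ.+ m ℕ.≤ y ℕ.+ n)
  [x-n]≤[y-m]⇔[x+m]≤[y+n] x n y m = mk⇔ to from
    where
    cancelˡ : ∀ (a b c : ℤ) → (a - b) ℤ.+ (b ℤ.+ c) ≡ a ℤ.+ c
    cancelˡ = solve-∀
    cancelʳ : ∀ (a b c : ℤ) → (a - c) ℤ.+ (b ℤ.+ c) ≡ a ℤ.+ b
    cancelʳ = solve-∀
    uncancelˡ : ∀ (a b c : ℤ) → (a ℤ.+ c) ℤ.+ (- b - c) ≡ a - b
    uncancelˡ = solve-∀
    uncancelʳ : ∀ (a b c : ℤ) → (a ℤ.+ b) ℤ.+ (- b - c) ≡ a - c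
    uncancelʳ = solve-∀
    to : + x - + n ≤ + y - + m → x ℕ.+ m ℕ.≤ y ℕ.+ n
    to le = drop‿+≤+ (subst₂ _≤_ (trans (cancelˡ (+ x) (+ n) (+ m)) (sym (pos-+ x m)))
                                 (trans (cancelʳ (+ y) (+ n) (+ m)) (sym (pos-+ y n)))
                                 (+-monoˡ-≤ (+ n ℤ.+ + m) le))
    from : x ℕ.+ m ℕ.≤ y ℕ.+ n → + x - + n ≤ + y - + m
    from le = subst₂ _≤_ (trans (cong (ℤ._+ (- + n - + m)) (pos-+ x m)) (uncancelˡ (+ x) (+ n) (+ m)))
                         (trans (cong (ℤ._+ (- + n - + m)) (pos-+ y n)) (uncancelʳ (+ y) (+ n) (+ m)))
                         (+-monoˡ-≤ (- + n - + m) (+≤+ le))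

  +-cancelʳ-⇔ : ∀ c {a b} → (a ℕ.+ c ℕ.≤ b ℕ.+ c) ⇔ (a ℕ.≤ b)
  +-cancelʳ-⇔ c = mk⇔ (ℕₚ.+-cancelʳ-≤ c _ _) (ℕₚ.+-monoˡ-≤ c)

  ≤b≡does : ∀ {P : Set} {i j} (p? : Dec P) → (i ≤ j) ⇔ P → (i ≤b j) ≡ does p?
  ≤b≡does p? i≤j⇔P = trans (isYes≗does (_ ℤ.≤? _)) (does-⇔ i≤j⇔P (_ ℤ.≤? _) p?)

  end : ℕ → ℕ → ℤ
  end i l = - (+ i) ℤ.+ + l - + 1

  end≡ : ∀ i l → end i l ≡ + l - + suc i
  end≡ i l = trans (rearrange (+ i) (+ l)) (cong (λ k → + l - k) (sym (pos-+ 1 i)))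
    where
    rearrange : ∀ (a b : ℤ) → - a ℤ.+ b - + 1 ≡ b - (+ 1 ℤ.+ a)
    rearrange = solve-∀

  start≡ : ∀ i → - (+ i) ≡ + 0 - + i
  start≡ i = sym (+-identityˡ (- (+ i)))

  end≤end⇔ : ∀ i x j y → (end i x ≤ end j y) ⇔ (x ℕ.+ suc j ℕ.≤ y ℕ.+ suc i)
  end≤end⇔ i x j y = subst₂ (λ a b → (a ≤ b) ⇔ (x ℕ.+ suc j ℕ.≤ y ℕ.+ suc i)) (sym (end≡ i x)) (sym (end≡ j y))
                            ([x-n]≤[y-m]⇔[x+m]≤[y+n] x (suc i) y (suc j))

  start≤end⇔ : ∀ i j y → (- (+ i) ≤ end j y) ⇔ (suc j ℕ.≤ y ℕ.+ i)
  start≤end⇔ i j y = subst₂ (λ a b → (a ≤ b) ⇔ (suc j ℕ.≤ y ℕ.+ i)) (sym (start≡ i)) (sym (end≡ j y))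
                            ([x-n]≤[y-m]⇔[x+m]≤[y+n] 0 i y (suc j))

  end≤b-end-suc : ∀ i x y → (end i x ≤b end (suc i) y) ≡ (x <ᵇ y)
  end≤b-end-suc i x y = ≤b≡does (x ℕₚ.<? y) (⇔-trans (end≤end⇔ i x (suc i) y)
    (subst (λ k → (k ℕ.≤ y ℕ.+ suc i) ⇔ (suc x ℕ.≤ y)) (sym (ℕₚ.+-suc x (suc i))) (+-cancelʳ-⇔ (suc i))))

  end-suc≤b-end : ∀ i x y → (end (suc i) y ≤b end i x) ≡ (y ≤ᵇ suc x)
  end-suc≤b-end i x y = ≤b≡does (y ℕₚ.≤? suc x) (⇔-trans (end≤end⇔ (suc i) y i x)
    (subst (λ k → (y ℕ.+ suc i ℕ.≤ k) ⇔ (y ℕ.≤ suc x)) (sym (ℕₚ.+-suc x (suc i))) (+-cancelʳ-⇔ (suc i))))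

  start≤b-end-suc : ∀ i y → (- (+ i) ≤b end (suc i) y) ≡ (2 ≤ᵇ y)
  start≤b-end-suc i y = ≤b≡does (2 ℕₚ.≤? y) (⇔-trans (start≤end⇔ i (suc i) y) (+-cancelʳ-⇔ i))

  start≤end : ∀ i {x} → 1 ℕ.≤ x → - (+ i) ≤ end i x
  start≤end i 1≤x = Equivalence.from (start≤end⇔ i i _) (ℕₚ.+-monoˡ-≤ i 1≤x)

  ends : ℕ → List ℕ → List ℤ
  ends i ls = map proj₂ (toShape i ls)

  nonincreasing-ends : ∀ i ls → nonincreasing (ends i ls) ≡ falling ls
  nonincreasing-ends i []           = refl
  nonincreasing-ends i (_ ∷ [])     = refl
  nonincreasing-ends i (x ∷ y ∷ ls) = cong₂ _∧_ (end-suc≤b-end i x y) (nonincreasing-ends (suc i) (y ∷ ls))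

  weaklyUnimodal-∷∷ : ∀ x y zs → weaklyUnimodal (x ∷ y ∷ zs) ≡
                      nonincreasing (x ∷ y ∷ zs) ∨ ((x ≤b y) ∧ weaklyUnimodal (y ∷ zs))
  weaklyUnimodal-∷∷ x y zs = cong (nonincreasing (x ∷ y ∷ zs) ∨_) (begin
    or (map Q (applyUpTo suc (suc n)))     ≡⟨ cong or (map-applyUpTo suc Q (suc n)) ⟩
    or (applyUpTo (Q ∘ suc) (suc n))       ≡⟨ or-applyUpTo-∧ (Q ∘ suc) Q′ (λ s → ∧-assoc (x ≤b y) _ _) (suc n) ⟩
    (x ≤b y) ∧ or (applyUpTo Q′ (suc n))   ≡⟨ cong (λ b → (x ≤b y) ∧ or b) (map-applyUpTo id Q′ (suc n)) ⟨
    (x ≤b y) ∧ or (map Q′ (upTo (suc n)))  ∎)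
    where
    open ≡-Reasoning
    n : ℕ
    n = length zs
    Q Q′ : ℕ → Bool
    Q  s = nondecreasing (take (suc s) (x ∷ y ∷ zs)) ∧ nonincreasing (drop s (x ∷ y ∷ zs))
    Q′ s = nondecreasing (take (suc s) (y ∷ zs)) ∧ nonincreasing (drop s (y ∷ zs))
    or-applyUpTo-∧ : ∀ f g {c} → (∀ s → f s ≡ c ∧ g s) → ∀ m → or (applyUpTo f m) ≡ c ∧ or (applyUpTo g m)
    or-applyUpTo-∧ f g {c} eq zero    = sym (∧-zeroʳ c)
    or-applyUpTo-∧ f g {c} eq (suc m) =
      trans (cong₂ _∨_ (eq 0) (or-applyUpTo-∧ (f ∘ suc) (g ∘ suc) (eq ∘ suc) m)) (sym (∧-distribˡ-∨ c _ _))

  weaklyUnimodal-ends : ∀ i ls → weaklyUnimodal (ends i ls) ≡ unimodal ls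
  weaklyUnimodal-ends i []           = refl
  weaklyUnimodal-ends i (_ ∷ [])     = refl
  weaklyUnimodal-ends i (x ∷ y ∷ ls) = trans (weaklyUnimodal-∷∷ (end i x) (end (suc i) y) (ends (suc (suc i)) ls))
    (cong₂ _∨_ (nonincreasing-ends i (x ∷ y ∷ ls))
               (cong₂ _∧_ (end≤b-end-suc i x y) (weaklyUnimodal-ends (suc i) (y ∷ ls))))

  ≤b-true : ∀ {i j} → i ≤ j → (i ≤b j) ≡ true
  ≤b-true i≤j = trans (isYes≗does (_ ℤ.≤? _)) (dec-true (_ ℤ.≤? _) i≤j)

  ==-true : ∀ {i j} → i ≡ j → (i == j) ≡ true
  ==-true i≡j = trans (isYes≗does (_ ℤ.≟ _)) (dec-true (_ ℤ.≟ _) i≡j)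

  rowsOverlap : Row → Row → Bool
  rowsOverlap r s = (proj₁ s == (proj₁ r - + 1)) ∧ (proj₁ r ≤b proj₂ s)

  consecutive-toShape : ∀ i x ls → consecutive rowsOverlap (toShape i (x ∷ ls)) ≡ all (2 ≤ᵇ_) ls
  consecutive-toShape i x []       = refl
  consecutive-toShape i x (y ∷ ls) =
    cong₂ _∧_ (cong₂ _∧_ (==-true (start-suc (+ i))) (start≤b-end-suc i y)) (consecutive-toShape (suc i) y ls)
    where
    start-suc : ∀ (a : ℤ) → - (+ 1 ℤ.+ a) ≡ - a - + 1
    start-suc = solve-∀

  nonempty-toShape : ∀ i ls → All (1 ℕ.≤_) ls → all (λ r → proj₁ r ≤b proj₂ r) (toShape i ls) ≡ true
  nonempty-toShape i []       []         = refl
  nonempty-toShape i (x ∷ ls) (1≤x ∷ ps) = cong₂ _∧_ (≤b-true (start≤end i 1≤x)) (nonempty-toShape (suc i) ls ps)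

  isShiftedStack-toShape : ∀ x ls → All (1 ℕ.≤_) (x ∷ ls) → isShiftedStack (toShape 0 (x ∷ ls)) ≡ isStack (x ∷ ls)
  isShiftedStack-toShape x ls ps
    rewrite nonempty-toShape 0 (x ∷ ls) ps | consecutive-toShape 0 x ls | weaklyUnimodal-ends 0 (x ∷ ls) = refl

  rowWidth-toShape : ∀ i l → rowWidth (- (+ i) , end i l) ≡ l
  rowWidth-toShape i l = cong ∣_∣ (cancel (+ i) (+ l))
    where
    cancel : ∀ (a b : ℤ) → ((- a ℤ.+ b - + 1) - (- a)) ℤ.+ + 1 ≡ b
    cancel = solve-∀

  area-toShape : ∀ i ls → area (toShape i ls) ≡ sum ls
  area-toShape i []       = refl
  area-toShape i (l ∷ ls) = cong₂ ℕ._+_ (rowWidth-toShape i l) (area-toShape (suc i) ls)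

  height-toShape : ∀ i ls → height (toShape i ls) ≡ length ls
  height-toShape i []       = refl
  height-toShape i (l ∷ ls) = cong suc (height-toShape (suc i) ls)

  topRowWidth-toShape : ∀ i ls → topRowWidth (toShape i ls) ≡ top ls
  topRowWidth-toShape i []           = refl
  topRowWidth-toShape i (l ∷ [])     = rowWidth-toShape i l
  topRowWidth-toShape i (_ ∷ l ∷ ls) = topRowWidth-toShape (suc i) (l ∷ ls)

  [x-k]⊔[y-k] : ∀ x y k → (+ x - k) ⊔ (+ y - k) ≡ + (x ℕ.⊔ y) - k
  [x-k]⊔[y-k] x y k with ℕₚ.≤-total x y
  ... | inj₁ x≤y = trans (i≤j⇒i⊔j≡j (+-monoˡ-≤ (- k) (+≤+ x≤y))) (cong (λ z → + z - k) (sym (ℕₚ.m≤n⇒m⊔n≡n x≤y)))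
  ... | inj₂ y≤x = trans (i≥j⇒i⊔j≡i (+-monoˡ-≤ (- k) (+≤+ y≤x))) (cong (λ z → + z - k) (sym (ℕₚ.m≥n⇒m⊔n≡m y≤x)))

  maxEnd : ℕ → List ℕ → ℤ
  maxEnd i ls = + spread ls - + (i ℕ.+ length ls)

  maxEnd-[] : ∀ i l → maxEnd i (l ∷ []) ≡ end i l
  maxEnd-[] i l = trans (cong₂ (λ a b → + a - + b) (trans (ℕₚ.⊔-identityʳ _) (ℕₚ.+-identityʳ l)) (ℕₚ.+-comm i 1))
                        (sym (end≡ i l))

  maxEnd-∷ : ∀ i l l′ ls → maxEnd i (l ∷ l′ ∷ ls) ≡ end i l ⊔ maxEnd (suc i) (l′ ∷ ls)
  maxEnd-∷ i l l′ ls = begin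
    + ((l ℕ.+ n) ℕ.⊔ spread (l′ ∷ ls)) - + (i ℕ.+ suc n)
      ≡⟨ [x-k]⊔[y-k] (l ℕ.+ n) (spread (l′ ∷ ls)) (+ (i ℕ.+ suc n)) ⟨
    (+ (l ℕ.+ n) - + (i ℕ.+ suc n)) ⊔ (+ spread (l′ ∷ ls) - + (i ℕ.+ suc n))
      ≡⟨ cong₂ _⊔_ (trans shift (sym (end≡ i l)))
                   (cong (λ k → + spread (l′ ∷ ls) - + k) (ℕₚ.+-suc i n)) ⟩
    end i l ⊔ maxEnd (suc i) (l′ ∷ ls)
      ∎
    where
    open ≡-Reasoning
    n : ℕ
    n = length (l′ ∷ ls)
    cancel : ∀ (a b c : ℤ) → (a ℤ.+ c) - (b ℤ.+ c) ≡ a - b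
    cancel = solve-∀
    shift : + (l ℕ.+ n) - + (i ℕ.+ suc n) ≡ + l - + suc i
    shift = trans (cong₂ _-_ (pos-+ l n) (trans (cong +_ (ℕₚ.+-suc i n)) (pos-+ (suc i) n)))
                  (cancel (+ l) (+ suc i) (+ n))

  end≤maxEnd : ∀ i l ls → end i l ≤ maxEnd i (l ∷ ls)
  end≤maxEnd i l []        = ≤-reflexive (sym (maxEnd-[] i l))
  end≤maxEnd i l (l′ ∷ ls) = subst (end i l ≤_) (sym (maxEnd-∷ i l l′ ls)) (i≤i⊔j _ _)

  leftmost-toShape : ∀ i l ls c →
    foldr (λ r m → proj₁ r ⊓ m) c (toShape i (l ∷ ls)) ≡ - (+ (i ℕ.+ length ls)) ⊓ c
  leftmost-toShape i l []        c = cong (λ k → - (+ k) ⊓ c) (sym (ℕₚ.+-identityʳ i))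
  leftmost-toShape i l (l′ ∷ ls) c = begin
    - (+ i) ⊓ foldr (λ r m → proj₁ r ⊓ m) c (toShape (suc i) (l′ ∷ ls))
      ≡⟨ cong (- (+ i) ⊓_) (leftmost-toShape (suc i) l′ ls c) ⟩
    - (+ i) ⊓ (- (+ (suc i ℕ.+ length ls)) ⊓ c)
      ≡⟨ ⊓-assoc (- (+ i)) _ c ⟨
    (- (+ i) ⊓ - (+ (suc i ℕ.+ length ls))) ⊓ c
      ≡⟨ cong (_⊓ c) (i≥j⇒i⊓j≡j (neg-mono-≤ (+≤+ (ℕₚ.≤-trans (ℕₚ.m≤m+n i (length ls)) (ℕₚ.n≤1+n _))))) ⟩
    - (+ (suc i ℕ.+ length ls)) ⊓ c
      ≡⟨ cong (λ k → - (+ k) ⊓ c) (ℕₚ.+-suc i (length ls)) ⟨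
    - (+ (i ℕ.+ suc (length ls))) ⊓ c
      ∎
    where open ≡-Reasoning

  rightmost-toShape : ∀ i l ls c →
    foldr (λ r m → proj₂ r ⊔ m) c (toShape i (l ∷ ls)) ≡ maxEnd i (l ∷ ls) ⊔ c
  rightmost-toShape i l []        c = cong (_⊔ c) (sym (maxEnd-[] i l))
  rightmost-toShape i l (l′ ∷ ls) c =
    trans (cong (end i l ⊔_) (rightmost-toShape (suc i) l′ ls c))
          (trans (sym (⊔-assoc (end i l) _ c)) (cong (_⊔ c) (sym (maxEnd-∷ i l l′ ls))))

  covers : ℤ → Row → Bool
  covers c r = (proj₁ r ≤b c) ∧ (c ≤b proj₂ r)

  covered : ∀ i l ls → all (2 ≤ᵇ_) ls ≡ true → ∀ {c} →
    - (+ (i ℕ.+ length ls)) ≤ c → c ≤ maxEnd i (l ∷ ls) → any (covers c) (toShape i (l ∷ ls)) ≡ true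
  covered i l [] _ {c} lo≤c c≤hi = cong (_∨ false) (cong₂ _∧_
    (≤b-true (subst (λ k → - (+ k) ≤ c) (ℕₚ.+-identityʳ i) lo≤c))
    (≤b-true (subst (c ≤_) (maxEnd-[] i l) c≤hi)))
  covered i l (l′ ∷ ls) overlaps {c} lo≤c c≤hi with c ℤ.≤? maxEnd (suc i) (l′ ∷ ls)
  ... | yes c≤M′ = trans (cong (covers c (- (+ i) , end i l) ∨_) (covered (suc i) l′ ls overlaps′ lo≤c′ c≤M′))
                         (∨-zeroʳ _)
    where
    overlaps′ : all (2 ≤ᵇ_) ls ≡ true
    overlaps′ = ∧-conicalʳ (2 ≤ᵇ l′) _ overlaps
    lo≤c′ : - (+ (suc i ℕ.+ length ls)) ≤ c
    lo≤c′ = subst (λ k → - (+ k) ≤ c) (ℕₚ.+-suc i (length ls)) lo≤c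
  ... | no c≰M′  = cong (_∨ _) (cong₂ _∧_ (≤b-true start≤c) (≤b-true c≤end))
    -- c lies beyond the row above, which ends at or after the start of row i since they overlap.
    where
    2≤l′ : 2 ℕ.≤ l′
    2≤l′ = ℕₚ.≤ᵇ⇒≤ 2 l′ (Equivalence.from T-≡ (∧-conicalˡ (2 ≤ᵇ l′) _ overlaps))
    start≤c : - (+ i) ≤ c
    start≤c = <⇒≤ (≤-<-trans (≤-trans (Equivalence.from (start≤end⇔ i (suc i) l′) (ℕₚ.+-monoˡ-≤ i 2≤l′))
                                      (end≤maxEnd (suc i) l′ ls))
                             (≰⇒> c≰M′))
    c≤end : c ≤ end i l
    c≤end with ≤-total (end i l) (maxEnd (suc i) (l′ ∷ ls))
    ... | inj₁ end≤M′ = contradiction (subst (c ≤_) (trans (maxEnd-∷ i l l′ ls) (i≤j⇒i⊔j≡j end≤M′)) c≤hi) c≰M′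
    ... | inj₂ M′≤end = subst (c ≤_) (trans (maxEnd-∷ i l l′ ls) (i≥j⇒i⊔j≡i M′≤end)) c≤hi

  length-filterᵇ-applyUpTo : ∀ {A : Set} (P : A → Bool) f N → (∀ {k} → k ℕ.< N → P (f k) ≡ true) →
                             length (filterᵇ P (applyUpTo f N)) ≡ N
  length-filterᵇ-applyUpTo P f N accepted =
    trans (cong length (filter-all (T? ∘ P) (applyUpTo⁺₁ f N (Equivalence.from T-≡ ∘ accepted))))
          (length-applyUpTo f N)

  ∣+w-1∣+1≡w : ∀ w → 1 ℕ.≤ w → ∣ + w - + 1 ∣ ℕ.+ 1 ≡ w
  ∣+w-1∣+1≡w (suc w) _ = trans (cong (λ z → ∣ z ∣ ℕ.+ 1) (trans (cong (_- + 1) (pos-+ 1 w)) (cancel (+ w))))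
                               (ℕₚ.+-comm w 1)
    where
    cancel : ∀ (a : ℤ) → (+ 1 ℤ.+ a) - + 1 ≡ a
    cancel = solve-∀

  width-toShape : ∀ l ls → 1 ℕ.≤ l → all (2 ≤ᵇ_) ls ≡ true → width (toShape 0 (l ∷ ls)) ≡ spread (l ∷ ls)
  width-toShape l ls 1≤l overlaps = count-columns lo≡ hi≡
    where
    n : ℕ
    n = length ls
    W : ℕ
    W = spread (l ∷ ls)
    column : ℕ → ℤ
    column k = - (+ n) ℤ.+ + k
    lo≡ : foldr (λ r m → proj₁ r ⊓ m) (- (+ 0)) (toShape 0 (l ∷ ls)) ≡ - (+ n)
    lo≡ = trans (leftmost-toShape 0 l ls (+ 0)) (i≤j⇒i⊓j≡i neg-≤-pos)
    hi≡ : foldr (λ r m → proj₂ r ⊔ m) (end 0 l) (toShape 0 (l ∷ ls)) ≡ + W - + suc n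
    hi≡ = trans (rightmost-toShape 0 l ls (end 0 l)) (i≥j⇒i⊔j≡i (end≤maxEnd 0 l ls))
    hi-lo : (+ W - + suc n) - - (+ n) ≡ + W - + 1
    hi-lo = trans (cong (λ k → (+ W - k) - - (+ n)) (pos-+ 1 n)) (cancel (+ W) (+ n))
      where
      cancel : ∀ (a b : ℤ) → (a - (+ 1 ℤ.+ b)) - - b ≡ a - + 1
      cancel = solve-∀
    1≤W : 1 ℕ.≤ W
    1≤W = ℕₚ.≤-trans 1≤l (l≤spread l ls)
    column≤hi : ∀ {k} → k ℕ.< W → column k ≤ + W - + suc n
    column≤hi {k} k<W = subst (_≤ + W - + suc n) (swap (+ n) (+ k))
      (Equivalence.from ([x-n]≤[y-m]⇔[x+m]≤[y+n] k n W (suc n))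
        (subst (ℕ._≤ W ℕ.+ n) (sym (ℕₚ.+-suc k n)) (ℕₚ.+-monoˡ-≤ n k<W)))
      where
      swap : ∀ (a b : ℤ) → b - a ≡ - a ℤ.+ b
      swap = solve-∀
    count-columns : ∀ {lo hi} → lo ≡ - (+ n) → hi ≡ + W - + suc n →
      length (filterᵇ (λ c → any (covers c) (toShape 0 (l ∷ ls))) (map (λ k → lo ℤ.+ + k) (upTo (∣ hi - lo ∣ ℕ.+ 1)))) ≡ W
    count-columns refl refl rewrite hi-lo | ∣+w-1∣+1≡w W 1≤W | map-applyUpTo id column W =
      length-filterᵇ-applyUpTo _ column W (λ k<W → covered 0 l ls overlaps (i≤i+j (- (+ n)) (+ _)) (column≤hi k<W))

module StackCounts where

  open import Data.Nat using (suc; _≡ᵇ_)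
  open import Data.Integer using (+_)
  open import Data.Bool using (true; false; _∧_)
  open import Data.Bool.Properties using (∧-conicalˡ; ∧-commutativeMonoid)
  open import Data.List using (_∷_; map)
  open import Data.List.Relation.Unary.All using (_∷_)
  open import Data.Nat.ListAction using (sum)
  open import Data.Product using (_,_)
  open import Relation.Binary.PropositionalEquality
  open import Algebra.Solver.CommutativeMonoid ∧-commutativeMonoid using (solve; _⊜_) renaming (_⊕_ to _&_)
  open import Defs
  open Counting
  open RowLengths
  open Shapes

  countStacks-byHeight : ∀ a p → countStacks a p ≡
    + ∑< a (λ n → count (suc n) a (λ ls → (isShiftedStack (toShape 0 ls) ∧ (area (toShape 0 ls) ≡ᵇ a)) ∧ p (toShape 0 ls)))
  countStacks-byHeight a p = cong +_ (trans (#ᵇ-filterᵇ p _ (candidates a))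
    (trans (#ᵇ-concatMap-upTo _ (λ n → map (toShape 0) (lengthLists (suc n) a)) a)
           (∑<-cong a (λ n _ → #ᵇ-map _ (toShape 0) (lengthLists (suc n) a)))))

  withTop-toShape : ∀ t w h a n ls → Lengths (suc n) ls →
    (isShiftedStack (toShape 0 ls) ∧ (area (toShape 0 ls) ≡ᵇ a)) ∧
      ((topRowWidth (toShape 0 ls) ≡ᵇ t) ∧ ((width (toShape 0 ls) ≡ᵇ w) ∧ (height (toShape 0 ls) ≡ᵇ h)))
    ≡ withTop t w a ls ∧ (suc n ≡ᵇ h)
  withTop-toShape t w h a n (l ∷ ls) (len , pos@(1≤l ∷ _))
    rewrite isShiftedStack-toShape l ls pos | area-toShape 0 (l ∷ ls) | topRowWidth-toShape 0 (l ∷ ls)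
          | height-toShape 0 (l ∷ ls) | len
    with isStack (l ∷ ls) in stack
  ... | false = refl
  ... | true rewrite width-toShape l ls 1≤l (∧-conicalˡ _ _ stack) =
    solve 4 (λ A T W H → A & (T & (W & H)) ⊜ ((A & W) & T) & H) refl
      (sum (l ∷ ls) ≡ᵇ a) (top (l ∷ ls) ≡ᵇ t) (spread (l ∷ ls) ≡ᵇ w) (suc n ≡ᵇ h)

  withWidth-toShape : ∀ w h a n ls → Lengths (suc n) ls →
    (isShiftedStack (toShape 0 ls) ∧ (area (toShape 0 ls) ≡ᵇ a)) ∧
      ((width (toShape 0 ls) ≡ᵇ w) ∧ (height (toShape 0 ls) ≡ᵇ h))
    ≡ withWidth w a ls ∧ (suc n ≡ᵇ h)
  withWidth-toShape w h a n (l ∷ ls) (len , pos@(1≤l ∷ _))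
    rewrite isShiftedStack-toShape l ls pos | area-toShape 0 (l ∷ ls) | height-toShape 0 (l ∷ ls) | len
    with isStack (l ∷ ls) in stack
  ... | false = refl
  ... | true rewrite width-toShape l ls 1≤l (∧-conicalˡ _ _ stack) =
    solve 3 (λ A W H → A & (W & H) ⊜ (A & W) & H) refl (sum (l ∷ ls) ≡ᵇ a) (spread (l ∷ ls) ≡ᵇ w) (suc n ≡ᵇ h)

  T-S≡#stacks : ∀ t w h a → T-S t w h a ≡ + #stacks t w h a
  T-S≡#stacks t w h a = trans (countStacks-byHeight a _) (cong +_ (trans
    (∑<-cong a (λ n _ → count-cong (suc n) a (withTop-toShape t w h a n)))
    (count-byHeight a h (withTop t w a) (withTop⇒sum≡ t w a) refl)))

  T-S1≡#stacks₁ : ∀ w h a → T-S1 0 w h a ≡ + #stacks₁ w h a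
  T-S1≡#stacks₁ w h a = trans (countStacks-byHeight a _) (cong +_ (trans
    (∑<-cong a (λ n _ → count-cong (suc n) a (withWidth-toShape w h a n)))
    (count-byHeight a h (withWidth w a) (withWidth⇒sum≡ w a) refl)))

module Recurrences where

  open import Data.Nat using (ℕ; zero; suc; _+_; _∸_; _≤_; _<_; z≤n; s≤s; _<ᵇ_; _≤ᵇ_; _≡ᵇ_)
  open import Data.Nat.Properties
  open import Data.Nat.ListAction using (sum)
  open import Data.Bool using (Bool; true; false; _∧_; not; if_then_else_)
  open import Data.Bool.Properties using (∧-zeroʳ; ∧-identityʳ; ∧-conicalˡ; ∧-conicalʳ; ∧-commutativeMonoid)
  open import Data.List using (List; []; _∷_; _∷ʳ_)
  open import Data.List.Relation.Unary.All using (All; []; _∷_)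
  open import Data.Product using (_,_)
  open import Function using (mk⇔)
  open import Relation.Binary.PropositionalEquality
  open import Relation.Nullary.Decidable using (dec-true; dec-false; does-⇔)
  open import Relation.Nullary.Reflects using (Reflects; ofʸ; ofⁿ)
  open import Algebra.Solver.CommutativeMonoid ∧-commutativeMonoid using (solve; _⊜_) renaming (_⊕_ to _&_)
  open import Data.Bool.ListAction using (all)
  open Counting
  open RowLengths

  count-peelTop : ∀ h a t (P : List ℕ → Bool) →
    count (suc h) a (λ ls → P ls ∧ (top ls ≡ᵇ suc t)) ≡ (if t <ᵇ a then count h a (λ ls → P (ls ∷ʳ suc t)) else 0)
  count-peelTop h a t P =
    trans (count-∷ʳ h a _) (trans (∑<-pointed a t _ otherTop) (cong (λ n → if t <ᵇ a then n else 0) thisTop))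
    where
    topIs : ∀ x ls → P (ls ∷ʳ suc x) ∧ (top (ls ∷ʳ suc x) ≡ᵇ suc t) ≡ P (ls ∷ʳ suc x) ∧ (x ≡ᵇ t)
    topIs x ls = cong (λ n → P (ls ∷ʳ suc x) ∧ (n ≡ᵇ suc t)) (top-∷ʳ ls (suc x))
    otherTop : ∀ x → x ≢ t → count h a (λ ls → P (ls ∷ʳ suc x) ∧ (top (ls ∷ʳ suc x) ≡ᵇ suc t)) ≡ 0
    otherTop x x≢t = count-none h a (λ ls _ →
      trans (topIs x ls) (trans (cong (P (ls ∷ʳ suc x) ∧_) (dec-false (x ≟ t) x≢t)) (∧-zeroʳ _)))
    thisTop : count h a (λ ls → P (ls ∷ʳ suc t) ∧ (top (ls ∷ʳ suc t) ≡ᵇ suc t)) ≡ count h a (λ ls → P (ls ∷ʳ suc t))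
    thisTop = count-cong h a (λ ls _ →
      trans (topIs t ls) (trans (cong (P (ls ∷ʳ suc t) ∧_) (dec-true (t ≟ t) refl)) (∧-identityʳ _)))

  count-topZero : ∀ h a (P : List ℕ → Bool) → count (suc h) a (λ ls → P ls ∧ (top ls ≡ᵇ 0)) ≡ 0
  count-topZero h a P = trans (count-∷ʳ h a _) (∑<-zero a (λ x _ → count-none h a (λ ls _ →
    trans (cong (λ n → P (ls ∷ʳ suc x) ∧ (n ≡ᵇ 0)) (top-∷ʳ ls (suc x))) (∧-zeroʳ _))))

  sum-∷ʳ-≡ᵇ : ∀ ls {t a} → t ≤ a → (sum (ls ∷ʳ t) ≡ᵇ a) ≡ (sum ls ≡ᵇ a ∸ t)
  sum-∷ʳ-≡ᵇ ls {t} {a} t≤a = trans (cong (_≡ᵇ a) (sum-∷ʳ ls t)) (does-⇔ (mk⇔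
    (λ eq → trans (sym (m+n∸n≡m (sum ls) t)) (cong (_∸ t) eq))
    (λ eq → trans (cong (_+ t) eq) (m∸n+n≡m t≤a))) (sum ls + t ≟ a) (sum ls ≟ a ∸ t))

  rising-∷ʳ-suc : ∀ ls x → rising (ls ∷ʳ suc x) ≡ rising ls ∧ (top ls <ᵇ suc x)
  rising-∷ʳ-suc []       x = refl
  rising-∷ʳ-suc (l ∷ ls) x = rising-∷ʳ l ls (suc x)

  strictPartition : ℕ → ℕ → List ℕ → Bool
  strictPartition m b ls = (rising ls ∧ (sum ls ≡ᵇ b)) ∧ (top ls <ᵇ suc m)

  strictPartition⇒sum≡ : ∀ m b ls → strictPartition m b ls ≡ true → sum ls ≡ b
  strictPartition⇒sum≡ m b ls eq = ≡ᵇ-true⇒≡ (∧-conicalʳ (rising ls) _ (∧-conicalˡ _ (top ls <ᵇ suc m) eq))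

  #strict : ℕ → ℕ → ℕ → ℕ
  #strict m h b = count h b (strictPartition m b)

  #strictTop : ℕ → ℕ → ℕ → ℕ
  #strictTop j h b = count h b (λ ls → (rising ls ∧ (sum ls ≡ᵇ b)) ∧ (top ls ≡ᵇ j))

  #strict-byTop : ∀ m h b → #strict m h b ≡ ∑< (suc m) (λ j → #strictTop j h b)
  #strict-byTop m h b = count-below h b (λ ls → rising ls ∧ (sum ls ≡ᵇ b)) top (suc m)

  #strictTop-suc : ∀ m h b → #strictTop (suc m) (suc h) b ≡ (if m <ᵇ b then #strict m h (b ∸ suc m) else 0)
  #strictTop-suc m h b = trans (count-peelTop h b m _) (bounded (m <ᵇ b) (<ᵇ-reflects-< m b))
    where
    bounded : ∀ β → Reflects (m < b) β →
      (if β then count h b (λ ls → rising (ls ∷ʳ suc m) ∧ (sum (ls ∷ʳ suc m) ≡ᵇ b)) else 0) ≡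
      (if β then #strict m h (b ∸ suc m) else 0)
    bounded false _         = refl
    bounded true  (ofʸ m<b) = trans (count-cong h b (λ ls _ → belowTop ls))
      (count-bound h (b ∸ suc m) _ (strictPartition⇒sum≡ m (b ∸ suc m)) (m∸n≤m b (suc m)))
      where
      belowTop : ∀ ls → rising (ls ∷ʳ suc m) ∧ (sum (ls ∷ʳ suc m) ≡ᵇ b) ≡ strictPartition m (b ∸ suc m) ls
      belowTop ls rewrite rising-∷ʳ-suc ls m | sum-∷ʳ-≡ᵇ ls m<b =
        solve 3 (λ R L S → (R & L) & S ⊜ (R & S) & L) refl (rising ls) (top ls <ᵇ suc m) (sum ls ≡ᵇ b ∸ suc m)

  #strict-zeroHeight : ∀ m b → #strict m 0 b ≡ iverson (0 ≡ᵇ b)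
  #strict-zeroHeight m b = trans (count-zero b (strictPartition m b)) (cong iverson (∧-identityʳ (0 ≡ᵇ b)))

  #strict-zero : ∀ h b → #strict 0 (suc h) b ≡ 0
  #strict-zero h b = trans (#strict-byTop 0 (suc h) b) (cong (_+ 0) (count-topZero h b _))

  #strict-suc : ∀ m h b →
    #strict (suc m) (suc h) b ≡ #strict m (suc h) b + (if m <ᵇ b then #strict m h (b ∸ suc m) else 0)
  #strict-suc m h b = begin
    #strict (suc m) (suc h) b                        ≡⟨ #strict-byTop (suc m) (suc h) b ⟩
    ∑< (suc (suc m)) (λ j → #strictTop j (suc h) b)  ≡⟨ ∑<-suc (suc m) (λ j → #strictTop j (suc h) b) ⟩
    ∑< (suc m) (λ j → #strictTop j (suc h) b) + #strictTop (suc m) (suc h) b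
      ≡⟨ cong₂ _+_ (sym (#strict-byTop m (suc h) b)) (#strictTop-suc m h b) ⟩
    #strict m (suc h) b + (if m <ᵇ b then #strict m h (b ∸ suc m) else 0) ∎
    where open ≡-Reasoning

  #stacks-zeroHeight : ∀ t w a → #stacks t w 0 a ≡ 0
  #stacks-zeroHeight t w a = count-zero a (withTop t w a)

  #stacks-zeroTop : ∀ w h a → #stacks 0 w (suc h) a ≡ 0
  #stacks-zeroTop w h a = count-topZero h a (withWidth w a)

  #stacks-zeroWidth : ∀ t h a → #stacks t 0 (suc h) a ≡ 0
  #stacks-zeroWidth t h a = count-none (suc h) a noStack
    where
    noStack : ∀ ls → Lengths (suc h) ls → withTop t 0 a ls ≡ false
    noStack (l ∷ ls) (_ , 1≤l ∷ _) rewrite dec-false (spread (l ∷ ls) ≟ 0) (>⇒≢ (≤-trans 1≤l (l≤spread l ls))) =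
      cong (_∧ (top (l ∷ ls) ≡ᵇ t)) (∧-zeroʳ _)

  #stacks-tooLong : ∀ t w h a → a ≤ t → #stacks (suc t) w (suc h) a ≡ 0
  #stacks-tooLong t w h a a≤t rewrite count-peelTop h a t (withWidth w a) | dec-false (t <? a) (≤⇒≯ a≤t) = refl

  #stacks-unitCell : ∀ w a → #stacks 1 w 1 a ≡ iverson ((1 ≡ᵇ a) ∧ (1 ≡ᵇ w))
  #stacks-unitCell w zero    = count-peelTop 0 0 0 (withWidth w 0)
  #stacks-unitCell w (suc a) =
    trans (count-peelTop 0 (suc a) 0 (withWidth w (suc a))) (count-zero (suc a) (λ ls → withWidth w (suc a) (ls ∷ʳ 1)))

  #stacks-unitTop : ∀ w h a → #stacks 1 w (suc (suc h)) a ≡ 0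
  #stacks-unitTop w h a rewrite count-peelTop (suc h) a 0 (withWidth w a) with 0 <ᵇ a
  ... | false = refl
  ... | true  = count-none (suc h) a noStack
    where
    noStack : ∀ ls → Lengths (suc h) ls → withWidth w a (ls ∷ʳ 1) ≡ false
    noStack (l ∷ ls) _ rewrite isStack-∷ʳ l ls 1 | ∧-zeroʳ (all (2 ≤ᵇ_) ls) = refl

  withWidth-∷ʳ-falling : ∀ m w a ls → suc (suc m) ≤ a →
    withWidth (suc w) a (ls ∷ʳ suc (suc m)) ∧ not (top ls <ᵇ suc m) ≡
    withWidth w (a ∸ suc (suc m)) ls ∧ not (top ls <ᵇ suc m)
  withWidth-∷ʳ-falling m w a []       _   = ∧-zeroʳ (withWidth (suc w) a (suc (suc m) ∷ []))
  withWidth-∷ʳ-falling m w a (l ∷ ls) t≤a with top (l ∷ ls) <ᵇ suc m | <ᵇ-reflects-< (top (l ∷ ls)) (suc m)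
  ... | true  | _          = trans (∧-zeroʳ _) (sym (∧-zeroʳ _))
  ... | false | ofⁿ top≮1+m
    rewrite isStack-∷ʳ-falling l ls (suc (suc m)) (s≤s (s≤s z≤n)) (s≤s (≮⇒≥ top≮1+m))
          | sum-∷ʳ-≡ᵇ (l ∷ ls) t≤a
          | spread-∷ʳ-falling l ls (suc (suc m)) (s≤s (≮⇒≥ top≮1+m)) = refl

  withWidth-∷ʳ-rising : ∀ m w a ls → All (1 ≤_) ls → suc (suc m) ≤ a →
    withWidth w a (ls ∷ʳ suc (suc m)) ∧ (top ls <ᵇ suc m) ≡
    strictPartition m (a ∸ suc (suc m)) ls ∧ (suc (suc m) ≡ᵇ w)
  withWidth-∷ʳ-rising m w a [] _ t≤a
    rewrite sum-∷ʳ-≡ᵇ [] t≤a | ⊔-identityʳ (suc (suc m) + 0) | +-identityʳ (suc (suc m)) =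
    trans (∧-identityʳ _) (cong (_∧ (suc (suc m) ≡ᵇ w)) (sym (∧-identityʳ _)))
  withWidth-∷ʳ-rising m w a (l ∷ ls) (1≤l ∷ _) t≤a with top (l ∷ ls) <ᵇ suc m | <ᵇ-reflects-< (top (l ∷ ls)) (suc m)
  ... | false | _          = trans (∧-zeroʳ _) (sym (cong (_∧ (suc (suc m) ≡ᵇ w)) (∧-zeroʳ _)))
  ... | true  | ofʸ top<1+m
    rewrite isStack-∷ʳ-rising l ls (suc (suc m)) 1≤l (s≤s top<1+m) | sum-∷ʳ-≡ᵇ (l ∷ ls) t≤a
    with rising (l ∷ ls) in rise
  ... | false = refl
  ... | true rewrite spread-∷ʳ-rising l ls (suc (suc m)) rise (<-trans top<1+m (n<1+n (suc m))) =
    trans (∧-identityʳ _) (cong (_∧ (suc (suc m) ≡ᵇ w)) (sym (∧-identityʳ _)))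

  withWidthTopAbove : ℕ → ℕ → ℕ → List ℕ → Bool
  withWidthTopAbove m w a ls = withWidth w a ls ∧ not (top ls <ᵇ suc m)

  #stacksTopAbove : ℕ → ℕ → ℕ → ℕ → ℕ
  #stacksTopAbove m w h a = count h a (withWidthTopAbove m w a)

  #stacks-peel : ∀ m w h a → suc (suc m) ≤ a →
    #stacks (suc (suc m)) (suc w) (suc h) a ≡
      (if suc (suc m) ≡ᵇ suc w then #strict m h (a ∸ suc (suc m)) else 0) +
      #stacksTopAbove m w h (a ∸ suc (suc m))
  #stacks-peel m w h a t≤a
    rewrite count-peelTop h a (suc m) (withWidth (suc w) a) | dec-true (suc m <? a) t≤a = begin
    count h a (λ ls → withWidth (suc w) a (ls ∷ʳ t))
      ≡⟨ count-split h a _ (λ ls → top ls <ᵇ suc m) ⟩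
    count h a (λ ls → withWidth (suc w) a (ls ∷ʳ t) ∧ (top ls <ᵇ suc m)) +
    count h a (λ ls → withWidth (suc w) a (ls ∷ʳ t) ∧ not (top ls <ᵇ suc m))
      ≡⟨ cong₂ _+_ (count-cong h a (λ ls (_ , pos) → withWidth-∷ʳ-rising m (suc w) a ls pos t≤a))
                   (count-cong h a (λ ls _ → withWidth-∷ʳ-falling m w a ls t≤a)) ⟩
    count h a (λ ls → strictPartition m s ls ∧ (t ≡ᵇ suc w)) +
    count h a (λ ls → withWidth w s ls ∧ not (top ls <ᵇ suc m))
      ≡⟨ cong₂ _+_ (onlyWidth (t ≡ᵇ suc w)) (count-bound h s _ fallingSum (m∸n≤m a t)) ⟩
    (if t ≡ᵇ suc w then #strict m h s else 0) + #stacksTopAbove m w h s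
      ∎
    where
    open ≡-Reasoning
    t : ℕ
    t = suc (suc m)
    s : ℕ
    s = a ∸ t
    fallingSum : ∀ ls → withWidthTopAbove m w s ls ≡ true → sum ls ≡ s
    fallingSum ls eq = withWidth⇒sum≡ w s ls (∧-conicalˡ _ _ eq)
    onlyWidth : ∀ β → count h a (λ ls → strictPartition m s ls ∧ β) ≡ (if β then #strict m h s else 0)
    onlyWidth false = count-none h a (λ ls _ → ∧-zeroʳ _)
    onlyWidth true  = trans (count-cong h a (λ ls _ → ∧-identityʳ _))
                            (count-bound h s _ (strictPartition⇒sum≡ m s) (m∸n≤m a t))

  #stacks₁-byTop : ∀ m w h s → #stacks₁ w h s ≡ ∑< (suc m) (λ j → #stacks j w h s) + #stacksTopAbove m w h s
  #stacks₁-byTop m w h s = trans (count-split h s (withWidth w s) (λ ls → top ls <ᵇ suc m))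
                                 (cong (_+ #stacksTopAbove m w h s) (count-below h s (withWidth w s) top (suc m)))

module PowerSeries where

  open import Data.Nat as ℕ using (ℕ; zero; suc; _∸_; _≤ᵇ_; _≡ᵇ_; z≤n; s≤s)
  import Data.Nat.Properties as ℕₚ
  open import Data.Integer as ℤ using (ℤ; +_; _+_; _*_; _-_)
  open import Data.Integer.Properties
    using (+-identityˡ; +-identityʳ; +-comm; +-assoc; *-comm; *-zeroˡ; *-identityˡ; *-distribʳ-+; pos-+;
           +-commutativeSemigroup)
  open import Data.Integer.Tactic.RingSolver using (solve-∀)
  open import Algebra.Properties.CommutativeSemigroup +-commutativeSemigroup using (interchange)
  open import Data.Bool using (Bool; true; false; _∧_; if_then_else_)
  open import Data.List using (List; []; _∷_)
  open import Data.Bool.ListAction using (and)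
  open import Function using (_∘_; mk⇔)
  open import Relation.Binary.PropositionalEquality
  open import Relation.Nullary using (yes; no)
  open import Relation.Nullary.Decidable using (dec-true; dec-false; does-⇔)
  open import Defs
  open Counting using (∑<)

  -- A guard rather than a product with an indicator, so that it computes as soon as b does.
  when : Bool → ℤ → ℤ
  when b x = if b then x else + 0

  when-zero : ∀ b → when b (+ 0) ≡ + 0
  when-zero true  = refl
  when-zero false = refl

  ∑≤-cong : ∀ n {f g : ℕ → ℤ} → (∀ i → i ℕ.≤ n → f i ≡ g i) → ∑≤ n f ≡ ∑≤ n g
  ∑≤-cong zero    eq = eq 0 z≤n
  ∑≤-cong (suc n) eq = cong₂ _+_ (∑≤-cong n (λ i i≤n → eq i (ℕₚ.m≤n⇒m≤1+n i≤n))) (eq (suc n) ℕₚ.≤-refl)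

  ∑≤-zero : ∀ n {f : ℕ → ℤ} → (∀ i → i ℕ.≤ n → f i ≡ + 0) → ∑≤ n f ≡ + 0
  ∑≤-zero n eq = trans (∑≤-cong n eq) (zeros n)
    where
    zeros : ∀ n → ∑≤ n (λ _ → + 0) ≡ + 0
    zeros zero    = refl
    zeros (suc n) = trans (+-identityʳ _) (zeros n)

  ∑≤-pointed : ∀ n c (f : ℕ → ℤ) → (∀ i → i ℕ.≤ n → i ≢ c → f i ≡ + 0) → ∑≤ n f ≡ when (c ≤ᵇ n) (f c)
  ∑≤-pointed zero    zero    f eq = refl
  ∑≤-pointed zero    (suc c) f eq = eq 0 z≤n (λ ())
  ∑≤-pointed (suc n) c       f eq with c ℕ.≟ suc n
  ... | yes refl rewrite ∑≤-zero n (λ i i≤n → eq i (ℕₚ.m≤n⇒m≤1+n i≤n) (ℕₚ.<⇒≢ (s≤s i≤n)))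
                       | dec-true (suc n ℕₚ.≤? suc n) ℕₚ.≤-refl = +-identityˡ (f (suc n))
  ... | no c≢1+n rewrite ∑≤-pointed n c f (λ i i≤n → eq i (ℕₚ.m≤n⇒m≤1+n i≤n))
                       | eq (suc n) ℕₚ.≤-refl (c≢1+n ∘ sym) = trans (+-identityʳ _) (cong (λ b → when b (f c)) c≤n≡c≤1+n)
    where
    c≤n≡c≤1+n : (c ≤ᵇ n) ≡ (c ≤ᵇ suc n)
    c≤n≡c≤1+n = does-⇔ (mk⇔ ℕₚ.m≤n⇒m≤1+n (λ c≤1+n → ℕₚ.≤-pred (ℕₚ.≤∧≢⇒< c≤1+n c≢1+n))) (c ℕₚ.≤? n) (c ℕₚ.≤? suc n)

  ∑≤-shift : ∀ n (f : ℕ → ℤ) → ∑≤ (suc n) f ≡ f 0 + ∑≤ n (f ∘ suc)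
  ∑≤-shift zero    f = refl
  ∑≤-shift (suc n) f = trans (cong (_+ f (suc (suc n))) (∑≤-shift n f)) (+-assoc (f 0) _ _)

  ∑≤-reverse : ∀ n (f : ℕ → ℤ) → ∑≤ n (λ i → f (n ∸ i)) ≡ ∑≤ n f
  ∑≤-reverse zero    f = refl
  ∑≤-reverse (suc n) f = trans (∑≤-shift n (λ i → f (suc n ∸ i)))
    (trans (cong (λ s → f (suc n) + s) (∑≤-reverse n f)) (+-comm (f (suc n)) (∑≤ n f)))

  ∑≤-+ : ∀ n (f g : ℕ → ℤ) → ∑≤ n (λ i → f i + g i) ≡ ∑≤ n f + ∑≤ n g
  ∑≤-+ zero    f g = refl
  ∑≤-+ (suc n) f g = trans (cong (_+ (f (suc n) + g (suc n))) (∑≤-+ n f g)) (interchange (∑≤ n f) _ _ _)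

  ∑≤-- : ∀ n (f g : ℕ → ℤ) → ∑≤ n (λ i → f i - g i) ≡ ∑≤ n f - ∑≤ n g
  ∑≤-- zero    f g = refl
  ∑≤-- (suc n) f g = trans (cong (_+ (f (suc n) - g (suc n))) (∑≤-- n f g)) (regroup (∑≤ n f) (∑≤ n g) _ _)
    where
    regroup : ∀ (a b c d : ℤ) → (a - b) + (c - d) ≡ (a + c) - (b + d)
    regroup = solve-∀

  ∑<-∑≤ : ∀ m (f : ℕ → ℕ) → + ∑< (suc m) f ≡ ∑≤ m (λ j → + f j)
  ∑<-∑≤ zero    f = cong +_ (ℕₚ.+-identityʳ (f 0))
  ∑<-∑≤ (suc m) f = begin
    + ∑< (suc (suc m)) f                 ≡⟨ cong +_ (Counting.∑<-suc (suc m) f) ⟩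
    + (∑< (suc m) f ℕ.+ f (suc m))       ≡⟨ pos-+ (∑< (suc m) f) (f (suc m)) ⟩
    + ∑< (suc m) f + + f (suc m)         ≡⟨ cong (_+ + f (suc m)) (∑<-∑≤ m f) ⟩
    ∑≤ m (λ j → + f j) + + f (suc m)     ∎
    where open ≡-Reasoning

  ∑≤-when : ∀ n b (f : ℕ → ℤ) → ∑≤ n (λ i → when b (f i)) ≡ when b (∑≤ n f)
  ∑≤-when n false f = ∑≤-zero n (λ _ _ → refl)
  ∑≤-when n true  f = refl

  ∑≤-δ : ∀ n c (f : ℕ → ℤ) → ∑≤ n (λ i → when (c ≡ᵇ i) (f i)) ≡ when (c ≤ᵇ n) (f c)
  ∑≤-δ n c f = trans (∑≤-pointed n c _ (λ i _ i≢c → cong (λ b → when b (f i)) (dec-false (c ℕₚ.≟ i) (i≢c ∘ sym))))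
                     (cong (λ b → when (c ≤ᵇ n) (when b (f c))) (dec-true (c ℕₚ.≟ c) refl))

  ⊛-congˡ : ∀ {F F′} G → F ≈ F′ → F ⊛ G ≈ F′ ⊛ G
  ⊛-congˡ G eq t w h a = ∑≤-cong t (λ i _ → ∑≤-cong w (λ j _ → ∑≤-cong h (λ k _ → ∑≤-cong a (λ l _ →
    cong (_* G (t ∸ i) (w ∸ j) (h ∸ k) (a ∸ l)) (eq i j k l)))))

  ⊛-congʳ : ∀ F {G G′} → G ≈ G′ → F ⊛ G ≈ F ⊛ G′
  ⊛-congʳ F eq t w h a = ∑≤-cong t (λ i _ → ∑≤-cong w (λ j _ → ∑≤-cong h (λ k _ → ∑≤-cong a (λ l _ →
    cong (F i j k l *_) (eq (t ∸ i) (w ∸ j) (h ∸ k) (a ∸ l))))))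

  ⊛-distribʳ : ∀ F G H → (F ⊕ G) ⊛ H ≈ (F ⊛ H) ⊕ (G ⊛ H)
  ⊛-distribʳ F G H t w h a =
    trans (∑≤-cong t (λ i _ → trans (∑≤-cong w (λ j _ → trans (∑≤-cong h (λ k _ →
      trans (∑≤-cong a (λ l _ → *-distribʳ-+ (H (t ∸ i) (w ∸ j) (h ∸ k) (a ∸ l)) (F i j k l) (G i j k l)))
            (∑≤-+ a _ _))) (∑≤-+ h _ _))) (∑≤-+ w _ _))) (∑≤-+ t _ _)

  ⊛-comm : ∀ F G → F ⊛ G ≈ G ⊛ F
  ⊛-comm F G t w h a =
    trans (reflect t (λ i i′ → ∑≤ w λ j → ∑≤ h λ k → ∑≤ a λ l → F i j k l * G i′ (w ∸ j) (h ∸ k) (a ∸ l)))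
    (∑≤-cong t (λ i _ → trans (reflect w (λ j j′ → ∑≤ h λ k → ∑≤ a λ l → F (t ∸ i) j k l * G i j′ (h ∸ k) (a ∸ l)))
      (∑≤-cong w (λ j _ → trans (reflect h (λ k k′ → ∑≤ a λ l → F (t ∸ i) (w ∸ j) k l * G i j k′ (a ∸ l)))
        (∑≤-cong h (λ k _ → trans (reflect a (λ l l′ → F (t ∸ i) (w ∸ j) (h ∸ k) l * G i j k l′))
          (∑≤-cong a (λ l _ → *-comm (F (t ∸ i) (w ∸ j) (h ∸ k) (a ∸ l)) (G i j k l)))))))))
    where
    reflect : ∀ n (g : ℕ → ℕ → ℤ) → ∑≤ n (λ i → g i (n ∸ i)) ≡ ∑≤ n (λ i → g (n ∸ i) i)
    reflect n g = trans (sym (∑≤-reverse n (λ i → g i (n ∸ i))))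
                        (∑≤-cong n (λ i i≤n → cong (g (n ∸ i)) (ℕₚ.m∸[m∸n]≡n i≤n)))

  whens : List Bool → ℤ → ℤ
  whens []       x = x
  whens (b ∷ bs) x = when b (whens bs x)

  ∑≤-whens : ∀ n bs (f : ℕ → ℤ) → ∑≤ n (λ i → whens bs (f i)) ≡ whens bs (∑≤ n f)
  ∑≤-whens n []       f = refl
  ∑≤-whens n (b ∷ bs) f = trans (∑≤-when n b _) (cong (when b) (∑≤-whens n bs f))

  ∑≤-whens-δ : ∀ n bs c (f : ℕ → ℤ) → ∑≤ n (λ i → whens bs (when (c ≡ᵇ i) (f i))) ≡ whens bs (when (c ≤ᵇ n) (f c))
  ∑≤-whens-δ n bs c f = trans (∑≤-whens n bs _) (cong (whens bs) (∑≤-δ n c f))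

  whens-* : ∀ bs x y → whens bs x * y ≡ whens bs (x * y)
  whens-* []           x y = refl
  whens-* (false ∷ bs) x y = *-zeroˡ y
  whens-* (true  ∷ bs) x y = whens-* bs x y

  whens-zero : ∀ bs → whens bs (+ 0) ≡ + 0
  whens-zero []       = refl
  whens-zero (b ∷ bs) = trans (cong (when b) (whens-zero bs)) (when-zero b)

  whens≡when-and : ∀ bs x → whens bs x ≡ when (and bs) x
  whens≡when-and []           x = refl
  whens≡when-and (false ∷ bs) x = refl
  whens≡when-and (true  ∷ bs) x = whens≡when-and bs x

  indicator-* : ∀ b₁ b₂ b₃ b₄ x → (if b₁ ∧ (b₂ ∧ (b₃ ∧ b₄)) then + 1 else + 0) * x ≡ whens (b₁ ∷ b₂ ∷ b₃ ∷ b₄ ∷ []) x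
  indicator-* false _     _     _     x = *-zeroˡ x
  indicator-* true  false _     _     x = *-zeroˡ x
  indicator-* true  true  false _     x = *-zeroˡ x
  indicator-* true  true  true  false x = *-zeroˡ x
  indicator-* true  true  true  true  x = *-identityˡ x

  mono-⊛ : ∀ i j k l F t w h a → (mono i j k l ⊛ F) t w h a ≡
    whens ((i ≤ᵇ t) ∷ (j ≤ᵇ w) ∷ (k ≤ᵇ h) ∷ (l ≤ᵇ a) ∷ []) (F (t ∸ i) (w ∸ j) (h ∸ k) (a ∸ l))
  mono-⊛ i j k l F t w h a = begin
    (mono i j k l ⊛ F) t w h a
      ≡⟨ ∑≤-cong t (λ i′ _ → ∑≤-cong w (λ j′ _ → ∑≤-cong h (λ k′ _ → ∑≤-cong a (λ l′ _ →
           indicator-* (i ≡ᵇ i′) (j ≡ᵇ j′) (k ≡ᵇ k′) (l ≡ᵇ l′) (F (t ∸ i′) (w ∸ j′) (h ∸ k′) (a ∸ l′)))))) ⟩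
    (∑≤ t λ i′ → ∑≤ w λ j′ → ∑≤ h λ k′ → ∑≤ a λ l′ →
       whens ((i ≡ᵇ i′) ∷ (j ≡ᵇ j′) ∷ (k ≡ᵇ k′) ∷ []) (when (l ≡ᵇ l′) (F (t ∸ i′) (w ∸ j′) (h ∸ k′) (a ∸ l′))))
      ≡⟨ ∑≤-cong t (λ i′ _ → ∑≤-cong w (λ j′ _ → ∑≤-cong h (λ k′ _ →
           ∑≤-whens-δ a ((i ≡ᵇ i′) ∷ (j ≡ᵇ j′) ∷ (k ≡ᵇ k′) ∷ []) l _))) ⟩
    (∑≤ t λ i′ → ∑≤ w λ j′ → ∑≤ h λ k′ →
       whens ((i ≡ᵇ i′) ∷ (j ≡ᵇ j′) ∷ []) (when (k ≡ᵇ k′) (when (l ≤ᵇ a) (F (t ∸ i′) (w ∸ j′) (h ∸ k′) (a ∸ l)))))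
      ≡⟨ ∑≤-cong t (λ i′ _ → ∑≤-cong w (λ j′ _ → ∑≤-whens-δ h ((i ≡ᵇ i′) ∷ (j ≡ᵇ j′) ∷ []) k _)) ⟩
    (∑≤ t λ i′ → ∑≤ w λ j′ →
       whens ((i ≡ᵇ i′) ∷ []) (when (j ≡ᵇ j′) (whens ((k ≤ᵇ h) ∷ (l ≤ᵇ a) ∷ []) (F (t ∸ i′) (w ∸ j′) (h ∸ k) (a ∸ l)))))
      ≡⟨ ∑≤-cong t (λ i′ _ → ∑≤-whens-δ w ((i ≡ᵇ i′) ∷ []) j _) ⟩
    (∑≤ t λ i′ → when (i ≡ᵇ i′) (whens ((j ≤ᵇ w) ∷ (k ≤ᵇ h) ∷ (l ≤ᵇ a) ∷ []) (F (t ∸ i′) (w ∸ j) (h ∸ k) (a ∸ l))))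
      ≡⟨ ∑≤-δ t i _ ⟩
    whens ((i ≤ᵇ t) ∷ (j ≤ᵇ w) ∷ (k ≤ᵇ h) ∷ (l ≤ᵇ a) ∷ []) (F (t ∸ i) (w ∸ j) (h ∸ k) (a ∸ l))
      ∎
    where open ≡-Reasoning

module SeriesCoefficients where

  open import Data.Nat as ℕ using (ℕ; zero; suc; _∸_; _≤ᵇ_; _<ᵇ_; _≡ᵇ_; s≤s)
  import Data.Nat.Properties as ℕₚ
  open import Data.Integer as ℤ using (ℤ; +_; _+_; _*_)
  open import Data.Integer.Properties using (+-identityˡ; +-identityʳ; *-identityˡ; pos-+)
  open import Data.Bool using (Bool; true; false; _∧_)
  open import Data.Bool.Properties using (∧-assoc; ∧-zeroʳ; ∧-identityʳ; ∧-commutativeMonoid)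
  open import Algebra.Solver.CommutativeMonoid ∧-commutativeMonoid using (solve; _⊜_) renaming (_⊕_ to _&_)
  open import Data.List using ([]; _∷_)
  open import Function using (mk⇔)
  open import Relation.Binary.PropositionalEquality
  open import Relation.Nullary.Decidable using (dec-true; dec-false; does-⇔)
  open import Defs
  open Recurrences using (#strict; #strict-zeroHeight; #strict-zero; #strict-suc)
  open PowerSeries

  uq^ : ∀ n → (mono 1 0 0 1 ^S n) ≈ mono n 0 0 n
  uq^ zero    t w h a = refl
  uq^ (suc n) t w h a =
    trans (⊛-congʳ (mono 1 0 0 1) (uq^ n) t w h a) (trans (mono-⊛ 1 0 0 1 (mono n 0 0 n) t w h a) (step t a))
    where
    step : ∀ t a → when (1 ≤ᵇ t) (when (1 ≤ᵇ a) (mono n 0 0 n (t ∸ 1) w h (a ∸ 1))) ≡ mono (suc n) 0 0 (suc n) t w h a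
    step zero    a       = refl
    step (suc t) zero    rewrite ∧-zeroʳ (0 ≡ᵇ h) | ∧-zeroʳ (0 ≡ᵇ w) | ∧-zeroʳ (n ≡ᵇ t) = refl
    step (suc t) (suc a) = refl

  uxq^ : ∀ n → (mono 1 1 0 1 ^S n) ≈ mono n n 0 n
  uxq^ zero    t w h a = refl
  uxq^ (suc n) t w h a =
    trans (⊛-congʳ (mono 1 1 0 1) (uxq^ n) t w h a) (trans (mono-⊛ 1 1 0 1 (mono n n 0 n) t w h a) (step t w a))
    where
    step : ∀ t w a → when (1 ≤ᵇ t) (when (1 ≤ᵇ w) (when (1 ≤ᵇ a) (mono n n 0 n (t ∸ 1) (w ∸ 1) h (a ∸ 1)))) ≡
                     mono (suc n) (suc n) 0 (suc n) t w h a
    step zero    w       a       = refl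
    step (suc t) zero    a       rewrite ∧-zeroʳ (n ≡ᵇ t) = refl
    step (suc t) (suc w) zero    rewrite ∧-zeroʳ (0 ≡ᵇ h) | ∧-zeroʳ (n ≡ᵇ w) | ∧-zeroʳ (n ≡ᵇ t) = refl
    step (suc t) (suc w) (suc a) = refl

  inv1-uq-coeff : ∀ t w h a → inv1-uq t w h a ≡ when ((0 ≡ᵇ w) ∧ ((0 ≡ᵇ h) ∧ (a ≡ᵇ t))) (+ 1)
  inv1-uq-coeff t w h a = begin
    ∑≤ a (λ m → (mono 1 0 0 1 ^S m) t w h a)  ≡⟨ ∑≤-cong a (λ m _ → uq^ m t w h a) ⟩
    ∑≤ a (λ m → mono m 0 0 m t w h a)          ≡⟨ ∑≤-pointed a a _ offDiagonal ⟩
    when (a ≤ᵇ a) (mono a 0 0 a t w h a)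
      ≡⟨ cong (λ b → when b (mono a 0 0 a t w h a)) (dec-true (a ℕₚ.≤? a) ℕₚ.≤-refl) ⟩
    mono a 0 0 a t w h a                        ≡⟨ cong (λ b → when b (+ 1)) diagonal ⟩
    when ((0 ≡ᵇ w) ∧ ((0 ≡ᵇ h) ∧ (a ≡ᵇ t))) (+ 1) ∎
    where
    open ≡-Reasoning
    offDiagonal : ∀ m → m ℕ.≤ a → m ≢ a → mono m 0 0 m t w h a ≡ + 0
    offDiagonal m _ m≢a rewrite dec-false (m ℕₚ.≟ a) m≢a | ∧-zeroʳ (0 ≡ᵇ h) | ∧-zeroʳ (0 ≡ᵇ w) | ∧-zeroʳ (m ≡ᵇ t) = refl
    diagonal : (a ≡ᵇ t) ∧ ((0 ≡ᵇ w) ∧ ((0 ≡ᵇ h) ∧ (a ≡ᵇ a))) ≡ (0 ≡ᵇ w) ∧ ((0 ≡ᵇ h) ∧ (a ≡ᵇ t))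
    diagonal rewrite dec-true (a ℕₚ.≟ a) refl | ∧-identityʳ (0 ≡ᵇ h) =
      solve 3 (λ T W H → T & (W & H) ⊜ W & (H & T)) refl (a ≡ᵇ t) (0 ≡ᵇ w) (0 ≡ᵇ h)

  poch-suc : ∀ m t w h b → poch (suc m) t w h b ≡
    poch m t w h b + when (1 ≤ᵇ h) (when (suc m ≤ᵇ b) (poch m t w (h ∸ 1) (b ∸ suc m)))
  poch-suc m t w h b = trans (⊛-comm (poch m) (oneS ⊕ mono 0 0 1 (suc m)) t w h b)
    (trans (⊛-distribʳ oneS (mono 0 0 1 (suc m)) (poch m) t w h b)
           (cong₂ _+_ (mono-⊛ 0 0 0 0 (poch m) t w h b) (mono-⊛ 0 0 1 (suc m) (poch m) t w h b)))

  poch-coeff : ∀ m t w h b → poch m t w h b ≡ when ((0 ≡ᵇ t) ∧ (0 ≡ᵇ w)) (+ #strict m h b)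
  poch-coeff zero    (suc t) w       h       b       = refl
  poch-coeff zero    zero    (suc w) h       b       = refl
  poch-coeff zero    zero    zero    zero    zero    = refl
  poch-coeff zero    zero    zero    zero    (suc b) = refl
  poch-coeff zero    zero    zero    (suc h) b       = cong +_ (sym (#strict-zero h b))
  poch-coeff (suc m) t w h b
    rewrite poch-suc m t w h b | poch-coeff m t w h b | poch-coeff m t w (h ∸ 1) (b ∸ suc m)
    with (0 ≡ᵇ t) ∧ (0 ≡ᵇ w)
  ... | false = trans (+-identityˡ _) (trans (cong (when (1 ≤ᵇ h)) (when-zero (suc m ≤ᵇ b))) (when-zero (1 ≤ᵇ h)))
  ... | true  = addTopPart h
    where
    addTopPart : ∀ h → + #strict m h b + when (1 ≤ᵇ h) (when (m <ᵇ b) (+ #strict m (h ∸ 1) (b ∸ suc m))) ≡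
                       + #strict (suc m) h b
    addTopPart zero    =
      trans (+-identityʳ _) (cong +_ (trans (#strict-zeroHeight m b) (sym (#strict-zeroHeight (suc m) b))))
    addTopPart (suc h) rewrite #strict-suc m h b with m <ᵇ b
    ... | true  = sym (pos-+ (#strict m (suc h) b) _)
    ... | false = trans (+-identityʳ _) (cong +_ (sym (ℕₚ.+-identityʳ _)))

  ≡ᵇ-comm : ∀ m n → (m ≡ᵇ n) ≡ (n ≡ᵇ m)
  ≡ᵇ-comm m n = does-⇔ (mk⇔ sym sym) (m ℕₚ.≟ n) (n ℕₚ.≟ m)

  ≤ᵇ-∧-∸≡ᵇ0 : ∀ k n → (k ≤ᵇ n) ∧ (0 ≡ᵇ n ∸ k) ≡ (k ≡ᵇ n)
  ≤ᵇ-∧-∸≡ᵇ0 zero          zero    = refl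
  ≤ᵇ-∧-∸≡ᵇ0 zero          (suc n) = refl
  ≤ᵇ-∧-∸≡ᵇ0 (suc k)       zero    = refl
  ≤ᵇ-∧-∸≡ᵇ0 (suc zero)    (suc n) = ≤ᵇ-∧-∸≡ᵇ0 zero n
  ≤ᵇ-∧-∸≡ᵇ0 (suc (suc k)) (suc n) = ≤ᵇ-∧-∸≡ᵇ0 (suc k) n

  2≤ᵇ-∧-∸2≡ᵇ∸2 : ∀ i l → (2 ≤ᵇ i) ∧ ((2 ≤ᵇ l) ∧ (l ∸ 2 ≡ᵇ i ∸ 2)) ≡ (i ≡ᵇ l) ∧ (2 ≤ᵇ i)
  2≤ᵇ-∧-∸2≡ᵇ∸2 zero          l             = sym (∧-zeroʳ (0 ≡ᵇ l))
  2≤ᵇ-∧-∸2≡ᵇ∸2 (suc zero)    l             = sym (∧-zeroʳ (1 ≡ᵇ l))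
  2≤ᵇ-∧-∸2≡ᵇ∸2 (suc (suc i)) zero          = refl
  2≤ᵇ-∧-∸2≡ᵇ∸2 (suc (suc i)) (suc zero)    = refl
  2≤ᵇ-∧-∸2≡ᵇ∸2 (suc (suc i)) (suc (suc l)) = trans (≡ᵇ-comm l i) (sym (∧-identityʳ (i ≡ᵇ l)))

  mono-⊛-poch : ∀ k j t w h a → (mono k k 0 k ⊛ poch j) t w h a ≡
    whens ((k ≡ᵇ t) ∷ (k ≡ᵇ w) ∷ (k ≤ᵇ a) ∷ []) (+ #strict j h (a ∸ k))
  mono-⊛-poch k j t w h a = begin
    (mono k k 0 k ⊛ poch j) t w h a
      ≡⟨ mono-⊛ k k 0 k (poch j) t w h a ⟩
    whens ((k ≤ᵇ t) ∷ (k ≤ᵇ w) ∷ (k ≤ᵇ a) ∷ []) (poch j (t ∸ k) (w ∸ k) h (a ∸ k))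
      ≡⟨ cong (whens ((k ≤ᵇ t) ∷ (k ≤ᵇ w) ∷ (k ≤ᵇ a) ∷ [])) (poch-coeff j (t ∸ k) (w ∸ k) h (a ∸ k)) ⟩
    whens ((k ≤ᵇ t) ∷ (k ≤ᵇ w) ∷ (k ≤ᵇ a) ∷ (T ∧ W) ∷ []) x
      ≡⟨ whens≡when-and ((k ≤ᵇ t) ∷ (k ≤ᵇ w) ∷ (k ≤ᵇ a) ∷ (T ∧ W) ∷ []) x ⟩
    when ((k ≤ᵇ t) ∧ ((k ≤ᵇ w) ∧ ((k ≤ᵇ a) ∧ ((T ∧ W) ∧ true)))) x
      ≡⟨ cong (λ b → when b x) regroup ⟩
    when (((k ≤ᵇ t) ∧ T) ∧ (((k ≤ᵇ w) ∧ W) ∧ ((k ≤ᵇ a) ∧ true))) x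
      ≡⟨ cong₂ (λ b c → when (b ∧ (c ∧ ((k ≤ᵇ a) ∧ true))) x) (≤ᵇ-∧-∸≡ᵇ0 k t) (≤ᵇ-∧-∸≡ᵇ0 k w) ⟩
    when ((k ≡ᵇ t) ∧ ((k ≡ᵇ w) ∧ ((k ≤ᵇ a) ∧ true))) x
      ≡⟨ whens≡when-and ((k ≡ᵇ t) ∷ (k ≡ᵇ w) ∷ (k ≤ᵇ a) ∷ []) x ⟨
    whens ((k ≡ᵇ t) ∷ (k ≡ᵇ w) ∷ (k ≤ᵇ a) ∷ []) x
      ∎
    where
    open ≡-Reasoning
    T W : Bool
    T = 0 ≡ᵇ t ∸ k
    W = 0 ≡ᵇ w ∸ k
    x : ℤ
    x = + #strict j h (a ∸ k)
    regroup : (k ≤ᵇ t) ∧ ((k ≤ᵇ w) ∧ ((k ≤ᵇ a) ∧ ((T ∧ W) ∧ true))) ≡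
              ((k ≤ᵇ t) ∧ T) ∧ (((k ≤ᵇ w) ∧ W) ∧ ((k ≤ᵇ a) ∧ true))
    regroup = solve 6 (λ Kt Kw Ka T W E → Kt & (Kw & (Ka & ((T & W) & E))) ⊜ (Kt & T) & ((Kw & W) & (Ka & E))) refl
                (k ≤ᵇ t) (k ≤ᵇ w) (k ≤ᵇ a) T W true

  P₁-sum : Series
  P₁-sum = Σq (λ j → (mono 1 1 0 1 ^S (j ℕ.+ 2)) ⊛ poch j)

  P₁-sum-term : ∀ j t w h a → ((mono 1 1 0 1 ^S (j ℕ.+ 2)) ⊛ poch j) t w h a ≡
    whens ((suc (suc j) ≡ᵇ t) ∷ (suc (suc j) ≡ᵇ w) ∷ (suc (suc j) ≤ᵇ a) ∷ []) (+ #strict j h (a ∸ suc (suc j)))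
  P₁-sum-term j t w h a rewrite ℕₚ.+-comm j 2 =
    trans (⊛-congˡ (poch j) (uxq^ (suc (suc j))) t w h a) (mono-⊛-poch (suc (suc j)) j t w h a)

  P₁-sum-short : ∀ t w h a → t ℕ.< 2 → P₁-sum t w h a ≡ + 0
  P₁-sum-short zero          w h a _ = ∑≤-zero a (λ j _ → P₁-sum-term j 0 w h a)
  P₁-sum-short (suc zero)    w h a _ = ∑≤-zero a (λ j _ → P₁-sum-term j 1 w h a)
  P₁-sum-short (suc (suc t)) w h a (s≤s (s≤s ()))

  P₁-sum-coeff : ∀ m w h a → P₁-sum (suc (suc m)) w h a ≡
    whens ((m ≤ᵇ a) ∷ (suc (suc m) ≡ᵇ w) ∷ (suc (suc m) ≤ᵇ a) ∷ []) (+ #strict m h (a ∸ suc (suc m)))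
  P₁-sum-coeff m w h a = trans (∑≤-cong a (λ j _ → trans (P₁-sum-term j (suc (suc m)) w h a)
                                                          (cong (λ b → when b (term j)) (≡ᵇ-comm j m))))
                                 (∑≤-δ a m term)
    where
    term : ℕ → ℤ
    term j = whens ((suc (suc j) ≡ᵇ w) ∷ (suc (suc j) ≤ᵇ a) ∷ []) (+ #strict j h (a ∸ suc (suc j)))

  P₁-coeff : ∀ t w h a → P₁ t w h a ≡ mono 1 1 1 1 t w h a + when (1 ≤ᵇ h) (P₁-sum t w (h ∸ 1) a)
  P₁-coeff t w h a = cong (λ x → mono 1 1 1 1 t w h a + x) (mono-⊛ 0 0 1 0 P₁-sum t w h a)

  kernel : Series
  kernel = mono 2 1 1 2 ⊛ inv1-uq

  kernel-coeff : ∀ i j k l → kernel i j k l ≡ whens ((1 ≡ᵇ j) ∷ (1 ≡ᵇ k) ∷ (i ≡ᵇ l) ∷ (2 ≤ᵇ i) ∷ []) (+ 1)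
  kernel-coeff i j k l = begin
    kernel i j k l
      ≡⟨ mono-⊛ 2 1 1 2 inv1-uq i j k l ⟩
    whens (i≥2 ∷ j≥1 ∷ k≥1 ∷ l≥2 ∷ []) (inv1-uq (i ∸ 2) (j ∸ 1) (k ∸ 1) (l ∸ 2))
      ≡⟨ cong (whens (i≥2 ∷ j≥1 ∷ k≥1 ∷ l≥2 ∷ [])) (inv1-uq-coeff (i ∸ 2) (j ∸ 1) (k ∸ 1) (l ∸ 2)) ⟩
    whens (i≥2 ∷ j≥1 ∷ k≥1 ∷ l≥2 ∷ (j∸1≡0 ∧ (k∸1≡0 ∧ l∸2≡i∸2)) ∷ []) (+ 1)
      ≡⟨ whens≡when-and (i≥2 ∷ j≥1 ∷ k≥1 ∷ l≥2 ∷ (j∸1≡0 ∧ (k∸1≡0 ∧ l∸2≡i∸2)) ∷ []) (+ 1) ⟩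
    when (i≥2 ∧ (j≥1 ∧ (k≥1 ∧ (l≥2 ∧ ((j∸1≡0 ∧ (k∸1≡0 ∧ l∸2≡i∸2)) ∧ true))))) (+ 1)
      ≡⟨ cong (λ b → when b (+ 1)) regroup ⟩
    when ((j≥1 ∧ j∸1≡0) ∧ ((k≥1 ∧ k∸1≡0) ∧ ((i≥2 ∧ (l≥2 ∧ l∸2≡i∸2)) ∧ true))) (+ 1)
      ≡⟨ cong₂ (λ b c → when (b ∧ (c ∧ ((i≥2 ∧ (l≥2 ∧ l∸2≡i∸2)) ∧ true))) (+ 1)) (≤ᵇ-∧-∸≡ᵇ0 1 j) (≤ᵇ-∧-∸≡ᵇ0 1 k) ⟩
    when ((1 ≡ᵇ j) ∧ ((1 ≡ᵇ k) ∧ ((i≥2 ∧ (l≥2 ∧ l∸2≡i∸2)) ∧ true))) (+ 1)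
      ≡⟨ cong (λ b → when ((1 ≡ᵇ j) ∧ ((1 ≡ᵇ k) ∧ b)) (+ 1))
              (trans (cong (_∧ true) (2≤ᵇ-∧-∸2≡ᵇ∸2 i l)) (∧-assoc (i ≡ᵇ l) (2 ≤ᵇ i) true)) ⟩
    when ((1 ≡ᵇ j) ∧ ((1 ≡ᵇ k) ∧ ((i ≡ᵇ l) ∧ ((2 ≤ᵇ i) ∧ true)))) (+ 1)
      ≡⟨ whens≡when-and ((1 ≡ᵇ j) ∷ (1 ≡ᵇ k) ∷ (i ≡ᵇ l) ∷ (2 ≤ᵇ i) ∷ []) (+ 1) ⟨
    whens ((1 ≡ᵇ j) ∷ (1 ≡ᵇ k) ∷ (i ≡ᵇ l) ∷ (2 ≤ᵇ i) ∷ []) (+ 1)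
      ∎
    where
    open ≡-Reasoning
    i≥2 j≥1 k≥1 l≥2 j∸1≡0 k∸1≡0 l∸2≡i∸2 : Bool
    i≥2 = 2 ≤ᵇ i
    j≥1 = 1 ≤ᵇ j
    k≥1 = 1 ≤ᵇ k
    l≥2 = 2 ≤ᵇ l
    j∸1≡0 = 0 ≡ᵇ j ∸ 1
    k∸1≡0 = 0 ≡ᵇ k ∸ 1
    l∸2≡i∸2 = l ∸ 2 ≡ᵇ i ∸ 2
    regroup : i≥2 ∧ (j≥1 ∧ (k≥1 ∧ (l≥2 ∧ ((j∸1≡0 ∧ (k∸1≡0 ∧ l∸2≡i∸2)) ∧ true)))) ≡
              (j≥1 ∧ j∸1≡0) ∧ ((k≥1 ∧ k∸1≡0) ∧ ((i≥2 ∧ (l≥2 ∧ l∸2≡i∸2)) ∧ true))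
    regroup = solve 8 (λ I J K L J′ K′ L′ E → I & (J & (K & (L & ((J′ & (K′ & L′)) & E)))) ⊜
                                              (J & J′) & ((K & K′) & ((I & (L & L′)) & E)))
                refl i≥2 j≥1 k≥1 l≥2 j∸1≡0 k∸1≡0 l∸2≡i∸2 true

  kernel-⊛ : ∀ G t w h a → (kernel ⊛ G) t w h a ≡
    whens ((1 ≤ᵇ w) ∷ (1 ≤ᵇ h) ∷ []) (∑≤ t (λ i → whens ((i ≤ᵇ a) ∷ (2 ≤ᵇ i) ∷ []) (G (t ∸ i) (w ∸ 1) (h ∸ 1) (a ∸ i))))
  kernel-⊛ G t w h a = begin
    (kernel ⊛ G) t w h a
      ≡⟨ ∑≤-cong t (λ i _ → ∑≤-cong w (λ j _ → ∑≤-cong h (λ k _ → ∑≤-cong a (λ l _ → term i j k l)))) ⟩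
    (∑≤ t λ i → ∑≤ w λ j → ∑≤ h λ k → ∑≤ a λ l →
       whens ((1 ≡ᵇ j) ∷ (1 ≡ᵇ k) ∷ []) (when (i ≡ᵇ l) (when (2 ≤ᵇ i) (G (t ∸ i) (w ∸ j) (h ∸ k) (a ∸ l)))))
      ≡⟨ ∑≤-cong t (λ i _ → ∑≤-cong w (λ j _ → ∑≤-cong h (λ k _ → ∑≤-whens-δ a ((1 ≡ᵇ j) ∷ (1 ≡ᵇ k) ∷ []) i _))) ⟩
    (∑≤ t λ i → ∑≤ w λ j → ∑≤ h λ k →
       whens ((1 ≡ᵇ j) ∷ []) (when (1 ≡ᵇ k) (whens ((i ≤ᵇ a) ∷ (2 ≤ᵇ i) ∷ []) (G (t ∸ i) (w ∸ j) (h ∸ k) (a ∸ i)))))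
      ≡⟨ ∑≤-cong t (λ i _ → ∑≤-cong w (λ j _ → ∑≤-whens-δ h ((1 ≡ᵇ j) ∷ []) 1 _)) ⟩
    (∑≤ t λ i → ∑≤ w λ j →
       when (1 ≡ᵇ j) (whens ((1 ≤ᵇ h) ∷ (i ≤ᵇ a) ∷ (2 ≤ᵇ i) ∷ []) (G (t ∸ i) (w ∸ j) (h ∸ 1) (a ∸ i))))
      ≡⟨ ∑≤-cong t (λ i _ → ∑≤-δ w 1 _) ⟩
    (∑≤ t λ i → whens ((1 ≤ᵇ w) ∷ (1 ≤ᵇ h) ∷ []) (whens ((i ≤ᵇ a) ∷ (2 ≤ᵇ i) ∷ []) (G (t ∸ i) (w ∸ 1) (h ∸ 1) (a ∸ i))))
      ≡⟨ ∑≤-whens t ((1 ≤ᵇ w) ∷ (1 ≤ᵇ h) ∷ []) _ ⟩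
    whens ((1 ≤ᵇ w) ∷ (1 ≤ᵇ h) ∷ []) (∑≤ t (λ i → whens ((i ≤ᵇ a) ∷ (2 ≤ᵇ i) ∷ []) (G (t ∸ i) (w ∸ 1) (h ∸ 1) (a ∸ i))))
      ∎
    where
    open ≡-Reasoning
    term : ∀ i j k l → kernel i j k l * G (t ∸ i) (w ∸ j) (h ∸ k) (a ∸ l) ≡
           whens ((1 ≡ᵇ j) ∷ (1 ≡ᵇ k) ∷ (i ≡ᵇ l) ∷ (2 ≤ᵇ i) ∷ []) (G (t ∸ i) (w ∸ j) (h ∸ k) (a ∸ l))
    term i j k l = trans (cong (_* G (t ∸ i) (w ∸ j) (h ∸ k) (a ∸ l)) (kernel-coeff i j k l))
      (trans (whens-* ((1 ≡ᵇ j) ∷ (1 ≡ᵇ k) ∷ (i ≡ᵇ l) ∷ (2 ≤ᵇ i) ∷ []) (+ 1) _)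
             (cong (whens ((1 ≡ᵇ j) ∷ (1 ≡ᵇ k) ∷ (i ≡ᵇ l) ∷ (2 ≤ᵇ i) ∷ [])) (*-identityˡ _)))

module FunctionalEquation where

  open import Data.Nat as ℕ using (ℕ; zero; suc; _∸_; _≤ᵇ_; _≡ᵇ_; z≤n; s≤s)
  import Data.Nat.Properties as ℕₚ
  open import Data.Integer as ℤ using (ℤ; +_; _+_; _-_)
  open import Data.Integer.Properties using (+-identityˡ; pos-+)
  open import Data.Integer.Tactic.RingSolver using (solve-∀)
  open import Data.Bool using (true; false; _∧_; if_then_else_)
  open import Data.Bool.Properties using (∧-zeroʳ; ∧-comm)
  open import Data.List using ([]; _∷_)
  open import Relation.Binary.PropositionalEquality
  open import Relation.Nullary using (¬_; yes; no; contradiction)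
  open import Relation.Nullary.Decidable using (dec-true; dec-false)
  open import Relation.Nullary.Reflects using (ofʸ)
  open import Defs
  open Counting using (∑<)
  open RowLengths using (#stacks; #stacks₁)
  open StackCounts using (T-S≡#stacks; T-S1≡#stacks₁)
  open Recurrences
  open PowerSeries
  open SeriesCoefficients

  G : Series
  G = T-S1 ⊖ substUq T-S

  substUq-≤ : ∀ F t w h a → t ℕ.≤ a → substUq F t w h a ≡ F t w h (a ∸ t)
  substUq-≤ F t w h a t≤a with t ℕ.≤? a
  ... | yes _   = refl
  ... | no t≰a  = contradiction t≤a t≰a

  G-beyond : ∀ x w h y → ¬ (suc x ℕ.≤ y) → G (suc x) w h y ≡ + 0
  G-beyond x w h y x≰y with suc x ℕ.≤? y
  ... | yes x≤y = contradiction x≤y x≰y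
  ... | no _    = refl

  kernelSum : ℕ → ℕ → ℕ → ℕ → ℤ
  kernelSum t w h a = ∑≤ t (λ i → whens ((i ≤ᵇ a) ∷ (2 ≤ᵇ i) ∷ []) (G (t ∸ i) w h (a ∸ i)))

  rhs : ℕ → ℕ → ℕ → ℕ → ℤ
  rhs t w h a = mono 1 1 1 1 t w h a + when (1 ≤ᵇ h) (P₁-sum t w (h ∸ 1) a) +
                whens ((1 ≤ᵇ w) ∷ (1 ≤ᵇ h) ∷ []) (kernelSum t (w ∸ 1) (h ∸ 1) a)

  rhs-coeff : ∀ t w h a → (P₁ ⊕ kernel ⊛ G) t w h a ≡ rhs t w h a
  rhs-coeff t w h a = cong₂ _+_ (P₁-coeff t w h a) (kernel-⊛ G t w h a)

  kernelSum-tooLong : ∀ t w h a → a ℕ.< t → kernelSum t w h a ≡ + 0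
  kernelSum-tooLong t w h a a<t = ∑≤-zero t term
    where
    term : ∀ i → i ℕ.≤ t → whens ((i ≤ᵇ a) ∷ (2 ≤ᵇ i) ∷ []) (G (t ∸ i) w h (a ∸ i)) ≡ + 0
    term i _ with i ≤ᵇ a | ℕₚ.≤ᵇ-reflects-≤ i a
    ... | false | _         = refl
    ... | true  | ofʸ i≤a with t ∸ i in t∸i | ℕₚ.m<n⇒0<n∸m (ℕₚ.≤-<-trans i≤a a<t)
    ...   | suc x | _ = trans (cong (when (2 ≤ᵇ i)) (G-beyond x w h (a ∸ i) beyond)) (when-zero (2 ≤ᵇ i))
      where
      beyond : ¬ (suc x ℕ.≤ a ∸ i)
      beyond x≤a∸i = ℕₚ.<⇒≱ a<t (subst₂ ℕ._≤_
        (trans (cong (ℕ._+ i) (sym t∸i)) (ℕₚ.m∸n+n≡m (ℕₚ.<⇒≤ (ℕₚ.≤-<-trans i≤a a<t))))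
        (ℕₚ.m∸n+n≡m i≤a) (ℕₚ.+-monoˡ-≤ i x≤a∸i))

  ∑≤-T-S1 : ∀ m w h (b : ℕ → ℕ) → ∑≤ m (λ j → T-S1 (m ∸ j) w h (b j)) ≡ + #stacks₁ w h (b m)
  ∑≤-T-S1 m w h b = begin
    ∑≤ m (λ j → T-S1 (m ∸ j) w h (b j))  ≡⟨ ∑≤-pointed m m _ belowTop ⟩
    when (m ≤ᵇ m) (T-S1 (m ∸ m) w h (b m))
      ≡⟨ cong₂ (λ c k → when c (T-S1 k w h (b m))) (dec-true (m ℕₚ.≤? m) ℕₚ.≤-refl) (ℕₚ.n∸n≡0 m) ⟩
    T-S1 0 w h (b m)                     ≡⟨ T-S1≡#stacks₁ w h (b m) ⟩
    + #stacks₁ w h (b m)                 ∎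
    where
    open ≡-Reasoning
    belowTop : ∀ j → j ℕ.≤ m → j ≢ m → T-S1 (m ∸ j) w h (b j) ≡ + 0
    belowTop j j≤m j≢m with m ∸ j | ℕₚ.m<n⇒0<n∸m (ℕₚ.≤∧≢⇒< j≤m j≢m)
    ... | suc _ | _ = refl

  kernelSum-eval : ∀ m w h a → suc (suc m) ℕ.≤ a → kernelSum (suc (suc m)) w h a ≡
    + #stacks₁ w h (a ∸ suc (suc m)) - ∑≤ m (λ j → + #stacks j w h (a ∸ suc (suc m)))
  kernelSum-eval m w h a t≤a = begin
    kernelSum (suc (suc m)) w h a
      ≡⟨ trans (∑≤-shift (suc m) f) (+-identityˡ _) ⟩
    ∑≤ (suc m) (λ i → f (suc i))
      ≡⟨ trans (∑≤-shift m (λ i → f (suc i))) (trans (cong (_+ ∑≤ m (λ j → f (suc (suc j)))) (when-zero (1 ≤ᵇ a)))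
                                                     (+-identityˡ _)) ⟩
    ∑≤ m (λ j → when (suc (suc j) ≤ᵇ a) (G (m ∸ j) w h (a ∸ suc (suc j))))
      ≡⟨ ∑≤-cong m (λ j j≤m → term j j≤m) ⟩
    ∑≤ m (λ j → T-S1 (m ∸ j) w h (a ∸ suc (suc j)) - T-S (m ∸ j) w h s)
      ≡⟨ ∑≤-- m _ _ ⟩
    ∑≤ m (λ j → T-S1 (m ∸ j) w h (a ∸ suc (suc j))) - ∑≤ m (λ j → T-S (m ∸ j) w h s)
      ≡⟨ cong₂ _-_ (∑≤-T-S1 m w h (λ j → a ∸ suc (suc j))) reversed ⟩
    + #stacks₁ w h s - ∑≤ m (λ j → + #stacks j w h s)
      ∎
    where
    open ≡-Reasoning
    s : ℕ
    s = a ∸ suc (suc m)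
    f : ℕ → ℤ
    f i = whens ((i ≤ᵇ a) ∷ (2 ≤ᵇ i) ∷ []) (G (suc (suc m) ∸ i) w h (a ∸ i))
    term : ∀ j → j ℕ.≤ m → when (suc (suc j) ≤ᵇ a) (G (m ∸ j) w h (a ∸ suc (suc j))) ≡
                           T-S1 (m ∸ j) w h (a ∸ suc (suc j)) - T-S (m ∸ j) w h s
    term j j≤m rewrite dec-true (suc (suc j) ℕₚ.≤? a) (ℕₚ.≤-trans (s≤s (s≤s j≤m)) t≤a) =
      cong (T-S1 (m ∸ j) w h (a ∸ suc (suc j)) -_)
        (trans (substUq-≤ T-S (m ∸ j) w h _ (ℕₚ.∸-monoˡ-≤ (suc (suc j)) t≤a))
               (cong (T-S (m ∸ j) w h) (trans (ℕₚ.∸-+-assoc a (suc (suc j)) (m ∸ j))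
                                              (cong (λ k → a ∸ suc (suc k)) (ℕₚ.m+[n∸m]≡n j≤m)))))
    reversed : ∑≤ m (λ j → T-S (m ∸ j) w h s) ≡ ∑≤ m (λ j → + #stacks j w h s)
    reversed = trans (∑≤-reverse m (λ j → T-S j w h s)) (∑≤-cong m (λ j _ → T-S≡#stacks j w h s))

  +-if : ∀ b n → + (if b then n else 0) ≡ when b (+ n)
  +-if true  n = refl
  +-if false n = refl

  #stacks≡rhs-zeroHeight : ∀ t w a → + #stacks t w 0 a ≡ rhs t w 0 a
  #stacks≡rhs-zeroHeight t w a
    rewrite #stacks-zeroHeight t w a | ∧-zeroʳ (1 ≡ᵇ w) | ∧-zeroʳ (1 ≡ᵇ t) | when-zero (1 ≤ᵇ w) = refl

  #stacks≡rhs-zeroTop : ∀ w h a → + #stacks 0 w (suc h) a ≡ rhs 0 w (suc h) a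
  #stacks≡rhs-zeroTop w h a
    rewrite #stacks-zeroTop w h a | P₁-sum-short 0 w h a (s≤s z≤n) | when-zero (1 ≤ᵇ w) = refl

  #stacks≡rhs-unitCell : ∀ w a → + #stacks 1 w 1 a ≡ rhs 1 w 1 a
  #stacks≡rhs-unitCell w a
    rewrite #stacks-unitCell w a | P₁-sum-short 1 w 0 a (s≤s (s≤s z≤n)) | when-zero (1 ≤ᵇ a) | when-zero (1 ≤ᵇ w)
          | ∧-comm (1 ≡ᵇ a) (1 ≡ᵇ w)
    with (1 ≡ᵇ w) ∧ (1 ≡ᵇ a)
  ... | true  = refl
  ... | false = refl

  #stacks≡rhs-unitTop : ∀ w h a → + #stacks 1 w (suc (suc h)) a ≡ rhs 1 w (suc (suc h)) a
  #stacks≡rhs-unitTop w h a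
    rewrite #stacks-unitTop w h a | ∧-zeroʳ (1 ≡ᵇ w) | P₁-sum-short 1 w (suc h) a (s≤s (s≤s z≤n))
          | when-zero (1 ≤ᵇ a) | when-zero (1 ≤ᵇ w) = refl

  #stacks≡rhs-tooLong : ∀ m w h a → a ℕ.< suc (suc m) →
                  + #stacks (suc (suc m)) w (suc h) a ≡ rhs (suc (suc m)) w (suc h) a
  #stacks≡rhs-tooLong m w h a a<t = trans (cong +_ (#stacks-tooLong (suc m) w h a (ℕₚ.≤-pred a<t)))
    (sym (cong₂ (λ x y → + 0 + x + y) noP₁-sum
      (trans (cong (when (1 ≤ᵇ w)) (kernelSum-tooLong (suc (suc m)) (w ∸ 1) h a a<t)) (when-zero (1 ≤ᵇ w)))))
    where
    noP₁-sum : P₁-sum (suc (suc m)) w h a ≡ + 0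
    noP₁-sum = trans (P₁-sum-coeff m w h a)
      (trans (cong (λ b → whens ((m ≤ᵇ a) ∷ (suc (suc m) ≡ᵇ w) ∷ b ∷ []) (+ #strict m h (a ∸ suc (suc m))))
                   (dec-false (suc (suc m) ℕₚ.≤? a) (ℕₚ.<⇒≱ a<t)))
             (whens-zero ((m ≤ᵇ a) ∷ (suc (suc m) ≡ᵇ w) ∷ [])))

  #stacks≡rhs-zeroWidth : ∀ m h a → + #stacks (suc (suc m)) 0 (suc h) a ≡ rhs (suc (suc m)) 0 (suc h) a
  #stacks≡rhs-zeroWidth m h a = trans (cong +_ (#stacks-zeroWidth (suc (suc m)) h a))
    (sym (cong (λ x → + 0 + x + + 0) (trans (P₁-sum-coeff m 0 h a) (when-zero (m ≤ᵇ a)))))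

  P₁-sum-peel : ∀ m w h a → suc (suc m) ℕ.≤ a →
    P₁-sum (suc (suc m)) w h a ≡ + (if suc (suc m) ≡ᵇ w then #strict m h (a ∸ suc (suc m)) else 0)
  P₁-sum-peel m w h a t≤a
    rewrite P₁-sum-coeff m w h a | dec-true (m ℕₚ.≤? a) (ℕₚ.≤-trans (ℕₚ.m≤n+m m 2) t≤a)
          | dec-true (suc (suc m) ℕₚ.≤? a) t≤a = sym (+-if _ _)

  kernelSum-peel : ∀ m w h a → suc (suc m) ℕ.≤ a →
    kernelSum (suc (suc m)) w h a ≡ + #stacksTopAbove m w h (a ∸ suc (suc m))
  kernelSum-peel m w h a t≤a = begin
    kernelSum (suc (suc m)) w h a                     ≡⟨ kernelSum-eval m w h a t≤a ⟩
    + #stacks₁ w h s - Σ                              ≡⟨ cong (λ n → + n - Σ) (#stacks₁-byTop m w h s) ⟩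
    + (∑< (suc m) (λ j → #stacks j w h s) ℕ.+ R) - Σ  ≡⟨ cong (_- Σ) (pos-+ _ R) ⟩
    (+ ∑< (suc m) (λ j → #stacks j w h s) + + R) - Σ  ≡⟨ cong (λ x → (x + + R) - Σ) (∑<-∑≤ m _) ⟩
    (Σ + + R) - Σ                                     ≡⟨ cancel Σ (+ R) ⟩
    + R                                               ∎
    where
    open ≡-Reasoning
    s : ℕ
    s = a ∸ suc (suc m)
    R : ℕ
    R = #stacksTopAbove m w h s
    Σ : ℤ
    Σ = ∑≤ m (λ j → + #stacks j w h s)
    cancel : ∀ (x y : ℤ) → (x + y) - x ≡ y
    cancel = solve-∀

  #stacks≡rhs-peel : ∀ m w h a → suc (suc m) ℕ.≤ a →
               + #stacks (suc (suc m)) (suc w) (suc h) a ≡ rhs (suc (suc m)) (suc w) (suc h) a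
  #stacks≡rhs-peel m w h a t≤a = begin
    + #stacks t (suc w) (suc h) a             ≡⟨ cong +_ (#stacks-peel m w h a t≤a) ⟩
    + (P ℕ.+ R)                               ≡⟨ pos-+ P R ⟩
    + P + + R                                 ≡⟨ cong₂ _+_ (P₁-sum-peel m (suc w) h a t≤a) (kernelSum-peel m w h a t≤a) ⟨
    P₁-sum t (suc w) h a + kernelSum t w h a  ≡⟨ cong (_+ kernelSum t w h a) (+-identityˡ (P₁-sum t (suc w) h a)) ⟨
    rhs t (suc w) (suc h) a                   ∎
    where
    open ≡-Reasoning
    t P R : ℕ
    t = suc (suc m)
    P = if t ≡ᵇ suc w then #strict m h (a ∸ t) else 0
    R = #stacksTopAbove m w h (a ∸ t)

  #stacks≡rhs : ∀ t w h a → + #stacks t w h a ≡ rhs t w h a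
  #stacks≡rhs t                   w       zero          a = #stacks≡rhs-zeroHeight t w a
  #stacks≡rhs zero                w       (suc h)       a = #stacks≡rhs-zeroTop w h a
  #stacks≡rhs (suc zero)          w       (suc zero)    a = #stacks≡rhs-unitCell w a
  #stacks≡rhs (suc zero)          w       (suc (suc h)) a = #stacks≡rhs-unitTop w h a
  #stacks≡rhs (suc (suc m))       w       (suc h)       a with suc (suc m) ℕₚ.≤? a
  ... | no  t≰a = #stacks≡rhs-tooLong m w h a (ℕₚ.≰⇒> t≰a)
  #stacks≡rhs (suc (suc m))       zero    (suc h)       a | yes t≤a = #stacks≡rhs-zeroWidth m h a
  #stacks≡rhs (suc (suc m))       (suc w) (suc h)       a | yes t≤a = #stacks≡rhs-peel m w h a t≤a

open import Data.Integer using (+_)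
open import Relation.Binary.PropositionalEquality using (module ≡-Reasoning)
open RowLengths using (#stacks)
open StackCounts using (T-S≡#stacks)
open FunctionalEquation using (rhs; rhs-coeff; #stacks≡rhs)

mainTheorem5 : T-S ≈ P₁ ⊕ (mono 2 1 1 2 ⊛ inv1-uq) ⊛ (T-S1 ⊖ substUq T-S)
mainTheorem5 t w h a = begin
  T-S t w h a                                                     ≡⟨ T-S≡#stacks t w h a ⟩
  + #stacks t w h a                                               ≡⟨ #stacks≡rhs t w h a ⟩
  rhs t w h a                                                     ≡⟨ rhs-coeff t w h a ⟨
  (P₁ ⊕ (mono 2 1 1 2 ⊛ inv1-uq) ⊛ (T-S1 ⊖ substUq T-S)) t w h a  ∎
  where open ≡-Reasoning
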